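{- Let $n \ge 2$ and $w_0 = n(n-1)\cdots 21 \in \mathfrak{S}_n$. Summing over all rhombic tilings $T \in T(w_0)$, the following quantities are all equal: the total number of top-perimeter tiles, the total number of bottom-perimeter tiles, for each $d \in [n-1]$ the total number of left-perimeter tiles of depth $d$, and for each $d \in [n-1]$ the total number of right-perimeter tiles of depth $d$.
   Context: For $w \in \mathfrak{S}_n$, Elnitsky's polygon $X(w)$ is the equilateral $2n$-gon constructed as follows: starting at the topmost vertex, label the sides $1,\ldots,n,w(n),\ldots,w(1)$ in counterclockwise order; the first $n$ sides (labeled $1,\ldots,n$, the "leftside boundary", from top vertex to bottom vertex) form half of a convex $2n$-gon; the remaining $n$ sides (the "rightside boundary") are drawn so that two sides are parallel (and congruent) iff they have the same label. A rhombic tiling of $X(w)$ is a tiling by rhombi whose edges are congruent and parallel to edges of $X(w)$; $T(w)$ is the set of these. In a tiling, every shortest path along tile edges from the top vertex to the bottom vertex has $n$ edges; a tile has depth $d+1$ if its topmost vertex is $d$ edges from the top vertex of $X(w)$ along a shortest path. A tile is a perimeter tile if it shares a path of at least two of its edges with the boundary of $X(w)$. A perimeter tile is left-perimeter if it contains two edges of the leftside boundary, right-perimeter if it contains two edges of the rightside boundary, top-perimeter if it contains the two boundary edges adjacent to the top vertex, bottom-perimeter if it contains the two boundary edges adjacent to the bottom vertex. -}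

module Defs where

-- Labels 1..n are represented by Fin n (label k+1 ↦ k).
-- A vertex of a tiling is the endpoint of a monotone path from the top vertex;
-- it is identified with the set of labels of the edges on that path (Subset n).
-- An edge is (start vertex, label); it goes from S to S ∪ {label}.

open import Data.Nat using (ℕ; zero; suc; _+_; _<ᵇ_)
open import Data.Bool using (Bool; true; false; if_then_else_; _∧_)
open import Data.Fin using (Fin; toℕ)
open import Data.Fin.Subset using (Subset; ⁅_⁆; _∪_; ∣_∣) renaming (⊥ to ∅)
open import Data.Fin.Properties using () renaming (_≟_ to _≟ᶠ_)
open import Data.Vec using (Vec; lookup; tabulate; replicate; toList; allFin; reverse; _[_]≔_)
open import Data.Vec.Properties using (≡-dec)
open import Data.Bool.Properties using () renaming (_≟_ to _≟ᵇ_)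
open import Data.List using (List; []; _∷_; foldr; map; take; length; concatMap)
open import Data.Nat.ListAction using (sum)
open import Data.Product using (_×_; _,_; Σ; ∃)
open import Data.Product.Properties using () renaming (≡-dec to ×-≡-dec)
open import Relation.Nullary using (does)
open import Relation.Binary.PropositionalEquality using (_≡_)
open import Data.Nat using (_<_)

_≟ˢ_ : ∀ {n} → (S T : Subset n) → _
_≟ˢ_ = ≡-dec _≟ᵇ_

-- A tile: labels i < j of its edges and its topmost vertex S.
-- Its vertices are S (top), S∪{i}, S∪{j}, S∪{i,j} (bottom).
record Tile (n : ℕ) : Set where
  constructor mkTile
  field
    lab₁ lab₂ : Fin n
    topV     : Subset n
open Tile public

Edge : ℕ → Set
Edge n = Subset n × Fin n

edgeEq : ∀ {n} → Edge n → Edge n → Bool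
edgeEq (S , a) (T , b) = does (S ≟ˢ T) ∧ does (a ≟ᶠ b)

tileEdges : ∀ {n} → Tile n → List (Edge n)
tileEdges (mkTile i j S) =
  (S , i) ∷ ((S ∪ ⁅ i ⁆) , j) ∷ (S , j) ∷ ((S ∪ ⁅ j ⁆) , i) ∷ []

lowerSet : ∀ {n} → Fin n → Subset n
lowerSet k = tabulate (λ m → toℕ m <ᵇ toℕ k)

upperSet : ∀ {n} → Fin n → Subset n
upperSet k = tabulate (λ m → toℕ k <ᵇ toℕ m)

-- leftside boundary of X(w₀): labels 1,…,n from top to bottom;
-- the edge labelled k starts at the vertex {labels < k}.
isLeftBdry : ∀ {n} → Edge n → Bool
isLeftBdry (S , k) = does (S ≟ˢ lowerSet k)

-- rightside boundary of X(w₀): labels w₀(1),…,w₀(n) = n,…,1 from top to bottom;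
-- the edge labelled k starts at the vertex {labels > k}.
isRightBdry : ∀ {n} → Edge n → Bool
isRightBdry (S , k) = does (S ≟ˢ upperSet k)

countᵇ : ∀ {A : Set} → (A → Bool) → List A → ℕ
countᵇ p [] = 0
countᵇ p (x ∷ xs) = if p x then suc (countᵇ p xs) else countᵇ p xs

anyᵇ : ∀ {A : Set} → (A → Bool) → List A → Bool
anyᵇ p [] = false
anyᵇ p (x ∷ xs) = if p x then true else anyᵇ p xs

hasEdge : ∀ {n} → Tile n → Edge n → Bool
hasEdge t e = anyᵇ (edgeEq e) (tileEdges t)

-- depth of a tile: (number of edges from top vertex to its topmost vertex) + 1
depth : ∀ {n} → Tile n → ℕ
depth t = suc ∣ topV t ∣

isLeftPerim : ∀ {n} → Tile n → Bool
isLeftPerim t = 2 ≤ᵇ countᵇ isLeftBdry (tileEdges t)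
  where
  _≤ᵇ_ : ℕ → ℕ → Bool
  a ≤ᵇ b = a <ᵇ suc b

isRightPerim : ∀ {n} → Tile n → Bool
isRightPerim t = 2 ≤ᵇ countᵇ isRightBdry (tileEdges t)
  where
  _≤ᵇ_ : ℕ → ℕ → Bool
  a ≤ᵇ b = a <ᵇ suc b

depthIs : ∀ {n} → ℕ → Tile n → Bool
depthIs d t = does (Data.Nat._≟_ d (depth t))
  where import Data.Nat

-- top-perimeter / bottom-perimeter tiles for n = m + 2 (labels 0 ≡ "1", fromℕ (suc m) ≡ "n")
module _ {m : ℕ} where
  private
    n = suc (suc m)
    first : Fin n
    first = Fin.zero
    last : Fin n
    last = Data.Fin.fromℕ (suc m)
      where import Data.Fin

  -- the two boundary edges at the top vertex: left edge labelled 1, right edge labelled n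
  isTopPerim : Tile n → Bool
  isTopPerim t = hasEdge t (lowerSet first , first) ∧ hasEdge t (upperSet last , last)

  -- the two boundary edges at the bottom vertex: left edge labelled n, right edge labelled 1
  isBottomPerim : Tile n → Bool
  isBottomPerim t = hasEdge t (lowerSet last , last) ∧ hasEdge t (upperSet first , first)

-- A tiling of X(w₀) is stored as a table: entry (i , j) for i < j is the topmost
-- vertex of the unique tile with edge labels i and j (entries with i ≥ j are ∅).
Tiling : ℕ → Set
Tiling n = Vec (Vec (Subset n) n) n

emptyTiling : ∀ {n} → Tiling n
emptyTiling = replicate _ (replicate _ ∅)

addTile : ∀ {n} → Tiling n → Fin n → Fin n → Subset n → Tiling n
addTile t i j S = t [ i ]≔ (lookup t i [ j ]≔ S)

prefixSet : ∀ {n} → Vec (Fin n) n → ℕ → Subset n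
prefixSet p a = foldr _∪_ ∅ (map ⁅_⁆ (take a (toList p)))

swapAt : ∀ {n} → Vec (Fin n) n → Fin n → Fin n → Vec (Fin n) n
swapAt p a b = (p [ a ]≔ lookup p b) [ b ]≔ lookup p a

-- Elnitsky's construction: tiles are added one at a time to the right of a
-- monotone top-to-bottom path (a word of labels), starting from the leftside
-- boundary.
data Reach (n : ℕ) : Vec (Fin n) n → Tiling n → Set where
  start : Reach n (allFin n) emptyTiling
  flip  : ∀ {p t} → Reach n p t → (a b : Fin n) → toℕ b ≡ suc (toℕ a) →
          toℕ (lookup p a) < toℕ (lookup p b) →
          Reach n (swapAt p a b) (addTile t (lookup p a) (lookup p b) (prefixSet p (toℕ a)))

-- T(w₀): tilings of the whole polygon (path reaches the rightside boundary n,…,1)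
IsTiling : ∀ n → Tiling n → Set
IsTiling n t = Reach n (reverse (allFin n)) t

tiles : ∀ {n} → Tiling n → List (Tile n)
tiles {n} t = concatMap (λ i → concatMap (λ j →
    if toℕ i <ᵇ toℕ j then mkTile i j (lookup (lookup t i) j) ∷ [] else [])
  (toList (allFin n))) (toList (allFin n))

total : ∀ {n} → (Tile n → Bool) → List (Tiling n) → ℕ
total P L = sum (map (λ t → countᵇ P (tiles t)) L)

-- Take X(w₀) to be the regular 2n-gon.  Rotating it by one edge, so that the end of
-- its first right-hand edge becomes the top vertex, maps rhombic tilings bijectively to
-- rhombic tilings and relabels the edge directions by k ↦ k+1, n ↦ 1.  It carries the
-- top-perimeter tile to the left-perimeter tile of depth 1, the left-perimeter tile of
-- depth d to that of depth d+1, the one of depth n-1 to the bottom-perimeter tile, that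
-- one to the right-perimeter tile of depth n-1, and the right-perimeter tile of depth
-- d+1 to that of depth d.  Summing over T(w₀), all these totals therefore agree.
--
-- Tilings are handled through their flip sequences from the leftside boundary.  That
-- the rotated tiling is again such a tiling follows by reordering a flip sequence so
-- that the flips involving the label n happen consecutively; relabelled, the flips
-- before, during and after that stretch form a flip sequence of the rotated tiling.

module Submission where

open import Defs
open import Data.Nat using (ℕ; suc; _≤_)
open import Data.Bool using (_∧_)
open import Data.Product using (_×_)
open import Data.List using (List)
open import Data.List.Membership.Propositional using (_∈_)
open import Data.List.Relation.Unary.Unique.Propositional using (Unique)
open import Relation.Binary.PropositionalEquality using (_≡_)

module Booleans where

  open import Data.Nat using (_<_; _<ᵇ_)
  open import Data.Nat.Properties using (<⇒<ᵇ; <ᵇ⇒<; <-irrefl; <-≤-trans)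
  open import Data.Bool using (Bool; true; false; T; if_then_else_; _∧_)
  open import Data.Bool.Properties using (T-≡)
  open import Data.Product using (_,_)
  open import Data.Empty using (⊥-elim)
  open import Function using (Equivalence)
  open import Relation.Nullary using (Dec; does; yes)
  open import Relation.Binary.PropositionalEquality using (refl)

  <⇒<ᵇ≡true : ∀ {m n} → m < n → (m <ᵇ n) ≡ true
  <⇒<ᵇ≡true m<n = Equivalence.to T-≡ (<⇒<ᵇ m<n)

  <ᵇ≡true⇒< : ∀ {m n} → (m <ᵇ n) ≡ true → m < n
  <ᵇ≡true⇒< {m} {n} e = <ᵇ⇒< m n (Equivalence.from T-≡ e)

  ≤⇒<ᵇ≡false : ∀ {m n} → n ≤ m → (m <ᵇ n) ≡ false
  ≤⇒<ᵇ≡false {m} {n} n≤m with m <ᵇ n in m<ᵇn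
  ... | false = refl
  ... | true  = ⊥-elim (<-irrefl refl (<-≤-trans (<ᵇ≡true⇒< m<ᵇn) n≤m))

  does≡true⇒ : ∀ {A : Set} (d : Dec A) → does d ≡ true → A
  does≡true⇒ (yes a) _ = a

  ∧≡true⇒ : ∀ {a b} → (a ∧ b) ≡ true → a ≡ true × b ≡ true
  ∧≡true⇒ {true} {true} _ = refl , refl

  if-true : ∀ {A : Set} {b} {p q : A} → T b → (if b then p else q) ≡ p
  if-true {b = true} _ = refl

module AllFin where

  open import Data.Nat using (zero)
  open import Data.Fin using (Fin; zero; suc; fromℕ; inject₁)
  open import Data.Vec using (Vec; []; _∷_; map; _∷ʳ_; allFin; reverse)
  open import Data.Vec.Properties using (map-∘; map-∷ʳ; map-reverse; allFin-map; reverse-∷)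
  open import Data.Vec.Relation.Unary.Unique.Propositional using () renaming (Unique to UniqueV)
  open import Data.Vec.Relation.Unary.Unique.Propositional.Properties using (tabulate⁺)
  open import Relation.Binary.PropositionalEquality using (refl; cong; sym; trans; module ≡-Reasoning)

  allFin-∷ʳ : ∀ n → allFin (suc n) ≡ map inject₁ (allFin n) ∷ʳ fromℕ n
  allFin-∷ʳ zero    = refl
  allFin-∷ʳ (suc n) = begin
    allFin (suc (suc n))
      ≡⟨ allFin-map (suc n) ⟩
    zero ∷ map suc (allFin (suc n))
      ≡⟨ cong (λ v → zero ∷ map suc v) (allFin-∷ʳ n) ⟩
    zero ∷ map suc (map inject₁ (allFin n) ∷ʳ fromℕ n)
      ≡⟨ cong (zero ∷_) (map-∷ʳ suc (fromℕ n) (map inject₁ (allFin n))) ⟩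
    zero ∷ (map suc (map inject₁ (allFin n)) ∷ʳ suc (fromℕ n))
      ≡⟨ cong (λ v → zero ∷ (v ∷ʳ suc (fromℕ n))) (trans (sym (map-∘ suc inject₁ (allFin n))) (map-∘ inject₁ suc (allFin n))) ⟩
    zero ∷ (map inject₁ (map suc (allFin n)) ∷ʳ suc (fromℕ n))
      ≡⟨ cong (λ v → map inject₁ v ∷ʳ fromℕ (suc n)) (allFin-map n) ⟨
    map inject₁ (allFin (suc n)) ∷ʳ fromℕ (suc n)
      ∎
    where open ≡-Reasoning

  reverse-∷ʳ : ∀ {A : Set} {m} (x : A) (xs : Vec A m) → reverse (xs ∷ʳ x) ≡ x ∷ reverse xs
  reverse-∷ʳ x []       = refl
  reverse-∷ʳ x (y ∷ xs) =
    trans (reverse-∷ y (xs ∷ʳ x)) (trans (cong (_∷ʳ y) (reverse-∷ʳ x xs)) (cong (x ∷_) (sym (reverse-∷ y xs))))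

  reverse-allFin : ∀ n → reverse (allFin (suc n)) ≡ fromℕ n ∷ map inject₁ (reverse (allFin n))
  reverse-allFin n = trans (cong reverse (allFin-∷ʳ n))
    (trans (reverse-∷ʳ (fromℕ n) (map inject₁ (allFin n))) (cong (fromℕ n ∷_) (sym (map-reverse inject₁ (allFin n)))))

  reverse-allFin-∷ʳ : ∀ n → reverse (allFin (suc n)) ≡ map suc (reverse (allFin n)) ∷ʳ zero
  reverse-allFin-∷ʳ n = trans (cong reverse (allFin-map n))
    (trans (reverse-∷ zero (map suc (allFin n))) (cong (_∷ʳ zero) (sym (map-reverse suc (allFin n)))))

  Unique-allFin : ∀ n → UniqueV (allFin n)
  Unique-allFin n = tabulate⁺ (λ e → e)

module AdjacentPositions where

  open import Data.Nat using (zero; _<_; z≤n; s≤s)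
  open import Data.Vec using (Vec; []; _∷_; map; _∷ʳ_)
  open import Data.Vec.Relation.Unary.All using (All; []; _∷_)
  open import Data.Vec.Relation.Unary.AllPairs using ([]; _∷_)
  open import Data.Vec.Relation.Unary.Unique.Propositional using () renaming (Unique to UniqueV)
  open import Data.Maybe using (Maybe; just; nothing)
  open import Data.Product using (Σ-syntax; _,_)
  open import Data.Sum using (_⊎_; inj₁; inj₂)
  open import Function using (_∘′_)
  open import Relation.Binary.PropositionalEquality using (refl; cong; sym)

  private variable
    A B : Set
    k : ℕ

  -- Positions are natural numbers; out of range, the operations below are
  -- the identity or return nothing.
  adjSwap : ℕ → Vec A k → Vec A k
  adjSwap zero    (x ∷ y ∷ v) = y ∷ x ∷ v
  adjSwap (suc a) (x ∷ v)     = x ∷ adjSwap a v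
  adjSwap _       v           = v

  adjPair : ℕ → Vec A k → Maybe (A × A)
  adjPair zero    (x ∷ y ∷ v) = just (x , y)
  adjPair (suc a) (x ∷ v)     = adjPair a v
  adjPair _       _           = nothing

  at : ℕ → Vec A k → Maybe A
  at zero    (x ∷ v) = just x
  at (suc i) (x ∷ v) = at i v
  at _       []      = nothing

  insert : ℕ → A → Vec A k → Vec A (suc k)
  insert zero    z v       = z ∷ v
  insert (suc r) z []      = z ∷ []
  insert (suc r) z (x ∷ v) = x ∷ insert r z v

  Apart : ℕ → ℕ → Set
  Apart c a = suc c < a ⊎ suc a < c

  adjSwap-comm-< : ∀ c a (v : Vec A k) → suc c < a →
                   adjSwap c (adjSwap a v) ≡ adjSwap a (adjSwap c v)
  adjSwap-comm-< zero    (suc (suc a)) []          _       = refl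
  adjSwap-comm-< zero    (suc (suc a)) (x ∷ [])    _       = refl
  adjSwap-comm-< zero    (suc (suc a)) (x ∷ y ∷ v) _       = refl
  adjSwap-comm-< (suc c) (suc a)       []          _       = refl
  adjSwap-comm-< (suc c) (suc a)       (x ∷ v)     (s≤s p) = cong (x ∷_) (adjSwap-comm-< c a v p)
  adjSwap-comm-< zero    (suc zero)    _           (s≤s ())

  adjSwap-comm : ∀ c a (v : Vec A k) → Apart c a →
                 adjSwap c (adjSwap a v) ≡ adjSwap a (adjSwap c v)
  adjSwap-comm c a v (inj₁ p) = adjSwap-comm-< c a v p
  adjSwap-comm c a v (inj₂ p) = sym (adjSwap-comm-< a c v p)

  adjPair-adjSwap-< : ∀ c a (v : Vec A k) → suc c < a → adjPair c (adjSwap a v) ≡ adjPair c v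
  adjPair-adjSwap-< zero    (suc (suc a)) []          _       = refl
  adjPair-adjSwap-< zero    (suc (suc a)) (x ∷ [])    _       = refl
  adjPair-adjSwap-< zero    (suc (suc a)) (x ∷ y ∷ v) _       = refl
  adjPair-adjSwap-< (suc c) (suc a)       []          _       = refl
  adjPair-adjSwap-< (suc c) (suc a)       (x ∷ v)     (s≤s p) = adjPair-adjSwap-< c a v p
  adjPair-adjSwap-< zero    (suc zero)    _           (s≤s ())

  adjPair-adjSwap-> : ∀ c a (v : Vec A k) → suc a < c → adjPair c (adjSwap a v) ≡ adjPair c v
  adjPair-adjSwap-> (suc (suc c)) zero    []          _       = refl
  adjPair-adjSwap-> (suc (suc c)) zero    (x ∷ [])    _       = refl
  adjPair-adjSwap-> (suc (suc c)) zero    (x ∷ y ∷ v) _       = refl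
  adjPair-adjSwap-> (suc c)       (suc a) []          _       = refl
  adjPair-adjSwap-> (suc c)       (suc a) (x ∷ v)     (s≤s p) = adjPair-adjSwap-> c a v p
  adjPair-adjSwap-> (suc zero)    zero    _           (s≤s ())

  adjPair-adjSwap : ∀ c a (v : Vec A k) → Apart c a → adjPair c (adjSwap a v) ≡ adjPair c v
  adjPair-adjSwap c a v (inj₁ p) = adjPair-adjSwap-< c a v p
  adjPair-adjSwap c a v (inj₂ p) = adjPair-adjSwap-> c a v p

  at-adjSwap : ∀ i a (v : Vec A k) → i < a ⊎ suc a < i → at i (adjSwap a v) ≡ at i v
  at-adjSwap zero          (suc a) []          _              = refl
  at-adjSwap zero          (suc a) (x ∷ v)     _              = refl
  at-adjSwap (suc i)       (suc a) []          _              = refl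
  at-adjSwap (suc i)       (suc a) (x ∷ v)     (inj₁ (s≤s p)) = at-adjSwap i a v (inj₁ p)
  at-adjSwap (suc i)       (suc a) (x ∷ v)     (inj₂ (s≤s p)) = at-adjSwap i a v (inj₂ p)
  at-adjSwap (suc (suc i)) zero    []          _              = refl
  at-adjSwap (suc (suc i)) zero    (x ∷ [])    _              = refl
  at-adjSwap (suc (suc i)) zero    (x ∷ y ∷ v) _              = refl
  at-adjSwap zero          zero    _           (inj₁ ())
  at-adjSwap zero          zero    _           (inj₂ ())
  at-adjSwap (suc zero)    zero    _           (inj₁ ())
  at-adjSwap (suc zero)    zero    _           (inj₂ (s≤s ()))

  adjSwap-involutive : ∀ a (v : Vec A k) → adjSwap a (adjSwap a v) ≡ v
  adjSwap-involutive zero    []          = refl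
  adjSwap-involutive zero    (x ∷ [])    = refl
  adjSwap-involutive zero    (x ∷ y ∷ v) = refl
  adjSwap-involutive (suc a) []          = refl
  adjSwap-involutive (suc a) (x ∷ v)     = cong (x ∷_) (adjSwap-involutive a v)

  adjPair⇒at : ∀ a (v : Vec A k) {x y} → adjPair a v ≡ just (x , y) →
               at a v ≡ just x × at (suc a) v ≡ just y
  adjPair⇒at zero    (x ∷ y ∷ v) refl = refl , refl
  adjPair⇒at (suc a) (x ∷ v)     e    = adjPair⇒at a v e

  at⇒adjPair : ∀ a (v : Vec A k) {x y} → at a v ≡ just x → at (suc a) v ≡ just y →
               adjPair a v ≡ just (x , y)
  at⇒adjPair zero    (x ∷ y ∷ v) refl refl = refl
  at⇒adjPair (suc a) (x ∷ v)     e    f    = at⇒adjPair a v e f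

  adjPair-bound : ∀ a (v : Vec A k) {p} → adjPair a v ≡ just p → suc a < k
  adjPair-bound zero    (x ∷ y ∷ v) e = s≤s (s≤s z≤n)
  adjPair-bound (suc a) (x ∷ v)     e = s≤s (adjPair-bound a v e)

  at-bound⁻ : ∀ i (v : Vec A k) → i < k → Σ[ x ∈ A ] at i v ≡ just x
  at-bound⁻ zero    (x ∷ v) _       = x , refl
  at-bound⁻ (suc i) (x ∷ v) (s≤s p) = at-bound⁻ i v p

  adjSwap-insert-suc : ∀ r (z : A) (v : Vec A k) → adjSwap r (insert (suc r) z v) ≡ insert r z v
  adjSwap-insert-suc zero          z []      = refl
  adjSwap-insert-suc zero          z (x ∷ v) = refl
  adjSwap-insert-suc (suc zero)    z []      = refl
  adjSwap-insert-suc (suc (suc r)) z []      = refl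
  adjSwap-insert-suc (suc r)       z (x ∷ v) = cong (x ∷_) (adjSwap-insert-suc r z v)

  adjSwap-insert : ∀ a r (z : A) (v : Vec A k) → suc a < r → r ≤ k →
                   adjSwap a (insert r z v) ≡ insert r z (adjSwap a v)
  adjSwap-insert zero    (suc (suc r)) z (x ∷ y ∷ v) _       _       = refl
  adjSwap-insert zero    (suc (suc r)) z (x ∷ [])    _       (s≤s ())
  adjSwap-insert (suc a) (suc r)       z (x ∷ v)     (s≤s p) (s≤s q) = cong (x ∷_) (adjSwap-insert a r z v p q)
  adjSwap-insert zero    (suc zero)    z _           (s≤s ()) _

  at-insert : ∀ r (z : A) (v : Vec A k) → r ≤ k → at r (insert r z v) ≡ just z
  at-insert zero    z v       _       = refl
  at-insert (suc r) z (x ∷ v) (s≤s p) = at-insert r z v p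

  at-insert-< : ∀ i r (z : A) (v : Vec A k) → i < r → r ≤ k → at i (insert r z v) ≡ at i v
  at-insert-< zero    (suc r) z (x ∷ v) _       _       = refl
  at-insert-< (suc i) (suc r) z (x ∷ v) (s≤s p) (s≤s q) = at-insert-< i r z v p q

  at-suc-insert : ∀ r (z : A) (v : Vec A k) → at (suc r) (insert r z v) ≡ at r v
  at-suc-insert zero    z v       = refl
  at-suc-insert (suc r) z []      = refl
  at-suc-insert (suc r) z (x ∷ v) = at-suc-insert r z v

  insert-length : ∀ (z : A) (v : Vec A k) → insert k z v ≡ v ∷ʳ z
  insert-length z []      = refl
  insert-length z (x ∷ v) = cong (x ∷_) (insert-length z v)

  adjPair-map : ∀ (f : A → B) a (v : Vec A k) {x y} → adjPair a v ≡ just (x , y) →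
                adjPair a (map f v) ≡ just (f x , f y)
  adjPair-map f zero    (x ∷ y ∷ v) refl = refl
  adjPair-map f (suc a) (x ∷ v)     e    = adjPair-map f a v e

  adjSwap-map : ∀ (f : A → B) a (v : Vec A k) → adjSwap a (map f v) ≡ map f (adjSwap a v)
  adjSwap-map f zero    []          = refl
  adjSwap-map f zero    (x ∷ [])    = refl
  adjSwap-map f zero    (x ∷ y ∷ v) = refl
  adjSwap-map f (suc a) []          = refl
  adjSwap-map f (suc a) (x ∷ v)     = cong (f x ∷_) (adjSwap-map f a v)

  adjPair-∷ʳ : ∀ a (v : Vec A k) (z : A) {p} → adjPair a v ≡ just p → adjPair a (v ∷ʳ z) ≡ just p
  adjPair-∷ʳ zero    (x ∷ y ∷ v) z refl = refl
  adjPair-∷ʳ (suc a) (x ∷ v)     z e    = adjPair-∷ʳ a v z e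

  adjSwap-∷ʳ : ∀ a (v : Vec A k) (z : A) {p} → adjPair a v ≡ just p →
               adjSwap a (v ∷ʳ z) ≡ adjSwap a v ∷ʳ z
  adjSwap-∷ʳ zero    (x ∷ y ∷ v) z refl = refl
  adjSwap-∷ʳ (suc a) (x ∷ v)     z e    = cong (x ∷_) (adjSwap-∷ʳ a v z e)

  All-adjSwap : ∀ {P : A → Set} a {v : Vec A k} → All P v → All P (adjSwap a v)
  All-adjSwap zero    (px ∷ py ∷ pv) = py ∷ px ∷ pv
  All-adjSwap zero    []             = []
  All-adjSwap zero    (px ∷ [])      = px ∷ []
  All-adjSwap (suc a) []             = []
  All-adjSwap (suc a) (px ∷ pv)      = px ∷ All-adjSwap a pv

  All-adjPair : ∀ {P : A → Set} a {v : Vec A k} → All P v → ∀ {x y} →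
                adjPair a v ≡ just (x , y) → P x × P y
  All-adjPair zero    (px ∷ py ∷ pv) refl = px , py
  All-adjPair (suc a) (px ∷ pv)      e    = All-adjPair a pv e

  All-at : ∀ {P : A → Set} i {v : Vec A k} → All P v → ∀ {x} → at i v ≡ just x → P x
  All-at zero    (px ∷ pv) refl = px
  All-at (suc i) (px ∷ pv) e    = All-at i pv e

  Unique-adjSwap : ∀ a {v : Vec A k} → UniqueV v → UniqueV (adjSwap a v)
  Unique-adjSwap zero    {x ∷ y ∷ w} ((x≢y ∷ x∉w) ∷ y∉w ∷ uw) = ((x≢y ∘′ sym) ∷ y∉w) ∷ x∉w ∷ uw
  Unique-adjSwap zero    {[]}        u             = u
  Unique-adjSwap zero    {x ∷ []}    u             = u
  Unique-adjSwap (suc a) {[]}        u             = u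
  Unique-adjSwap (suc a) {x ∷ v}     (x∉v ∷ uv)    = All-adjSwap a x∉v ∷ Unique-adjSwap a uv

module Subsets where

  open import Data.Nat using (zero; _<_; z≤n; s≤s)
  open import Data.Bool using (Bool; true; false; _∨_)
  open import Data.Bool.Properties using (∨-zeroʳ; ∨-identityʳ)
  open import Data.Fin using (Fin; zero; suc) renaming (_≟_ to _≟ᶠ_)
  open import Data.Fin.Subset using (Subset; ⁅_⁆; _∪_) renaming (⊥ to ∅)
  open import Data.Fin.Subset.Properties using (∪-assoc; ∪-comm)
  open import Data.Vec using (Vec; []; _∷_; lookup; tabulate; toList; _∷ʳ_)
  open import Data.Vec.Properties using (tabulate∘lookup; tabulate-cong; lookup-zipWith; lookup-replicate)
  open import Data.Vec.Relation.Unary.All using (All; []; _∷_)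
  open import Data.Vec.Relation.Unary.AllPairs using (_∷_)
  open import Data.Vec.Relation.Unary.Unique.Propositional using () renaming (Unique to UniqueV)
  open import Data.List using (take; foldr) renaming (map to mapˡ)
  open import Data.Maybe using (just)
  open import Data.Product using (_,_)
  open import Data.Sum using (_⊎_; inj₁; inj₂)
  open import Relation.Nullary using (does; yes; no)
  open import Relation.Nullary.Decidable using (dec-true; dec-false)
  open import Relation.Binary.PropositionalEquality using (_≢_; refl; cong; trans; module ≡-Reasoning)
  open ≡-Reasoning
  open AdjacentPositions

  private variable
    A : Set
    k k′ n : ℕ

  lookup-extensionality : {S T : Vec A n} → (∀ z → lookup S z ≡ lookup T z) → S ≡ T
  lookup-extensionality {S = S} {T} h = begin
    S                   ≡⟨ tabulate∘lookup S ⟨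
    tabulate (lookup S) ≡⟨ tabulate-cong h ⟩
    tabulate (lookup T) ≡⟨ tabulate∘lookup T ⟩
    T                   ∎

  lookup-∪ : (S T : Subset n) (z : Fin n) → lookup (S ∪ T) z ≡ lookup S z ∨ lookup T z
  lookup-∪ S T z = lookup-zipWith _∨_ z S T

  lookup-∅ : (z : Fin n) → lookup (∅ {n}) z ≡ false
  lookup-∅ z = lookup-replicate z false

  lookup-⁅⁆ : (x z : Fin n) → lookup ⁅ x ⁆ z ≡ does (x ≟ᶠ z)
  lookup-⁅⁆ zero    zero    = refl
  lookup-⁅⁆ zero    (suc z) = lookup-∅ z
  lookup-⁅⁆ (suc x) zero    = refl
  lookup-⁅⁆ (suc x) (suc z) with x ≟ᶠ z | lookup-⁅⁆ x z
  ... | yes refl | e = e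
  ... | no _     | e = e

  lookup-∪⁅⁆-≢ : (S : Subset n) {x z : Fin n} → x ≢ z → lookup (S ∪ ⁅ x ⁆) z ≡ lookup S z
  lookup-∪⁅⁆-≢ S {x} {z} x≢z = begin
    lookup (S ∪ ⁅ x ⁆) z       ≡⟨ lookup-∪ S ⁅ x ⁆ z ⟩
    lookup S z ∨ lookup ⁅ x ⁆ z ≡⟨ cong (lookup S z ∨_) (trans (lookup-⁅⁆ x z) (dec-false (x ≟ᶠ z) x≢z)) ⟩
    lookup S z ∨ false         ≡⟨ ∨-identityʳ _ ⟩
    lookup S z                 ∎

  lookup-∪⁅⁆-≡ : (S : Subset n) (x : Fin n) → lookup (S ∪ ⁅ x ⁆) x ≡ true
  lookup-∪⁅⁆-≡ S x = trans (lookup-∪ S ⁅ x ⁆ x)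
    (trans (cong (lookup S x ∨_) (trans (lookup-⁅⁆ x x) (dec-true (x ≟ᶠ x) refl))) (∨-zeroʳ _))

  lookup-⁅⁆∪-≡ : (S : Subset n) (x : Fin n) → lookup (⁅ x ⁆ ∪ S) x ≡ true
  lookup-⁅⁆∪-≡ S x = trans (cong (λ U → lookup U x) (∪-comm ⁅ x ⁆ S)) (lookup-∪⁅⁆-≡ S x)

  lookup-⁅⁆∪-≢ : (S : Subset n) {x z : Fin n} → x ≢ z → lookup (⁅ x ⁆ ∪ S) z ≡ lookup S z
  lookup-⁅⁆∪-≢ S {x} {z} x≢z = trans (cong (λ U → lookup U z) (∪-comm ⁅ x ⁆ S)) (lookup-∪⁅⁆-≢ S x≢z)

  -- The set of the first c labels of a word (Defs.prefixSet, for words of any length).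
  prefixOf : Vec (Fin n) k → ℕ → Subset n
  prefixOf v c = foldr _∪_ ∅ (mapˡ ⁅_⁆ (take c (toList v)))

  prefixOf-adjSwap-≤ : ∀ a c (v : Vec (Fin n) k) → c ≤ a → prefixOf (adjSwap a v) c ≡ prefixOf v c
  prefixOf-adjSwap-≤ a       zero    v       _       = refl
  prefixOf-adjSwap-≤ (suc a) (suc c) []      _       = refl
  prefixOf-adjSwap-≤ (suc a) (suc c) (x ∷ v) (s≤s p) = cong (⁅ x ⁆ ∪_) (prefixOf-adjSwap-≤ a c v p)

  prefixOf-adjSwap-> : ∀ a c (v : Vec (Fin n) k) → suc a < c → prefixOf (adjSwap a v) c ≡ prefixOf v c
  prefixOf-adjSwap-> {n = n} zero (suc (suc c)) (x ∷ y ∷ v) _ = begin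
    ⁅ y ⁆ ∪ (⁅ x ⁆ ∪ R) ≡⟨ ∪-assoc ⁅ y ⁆ ⁅ x ⁆ R ⟨
    (⁅ y ⁆ ∪ ⁅ x ⁆) ∪ R ≡⟨ cong (_∪ R) (∪-comm ⁅ y ⁆ ⁅ x ⁆) ⟩
    (⁅ x ⁆ ∪ ⁅ y ⁆) ∪ R ≡⟨ ∪-assoc ⁅ x ⁆ ⁅ y ⁆ R ⟩
    ⁅ x ⁆ ∪ (⁅ y ⁆ ∪ R) ∎
    where
    R : Subset n
    R = prefixOf v c
  prefixOf-adjSwap-> zero    (suc (suc c)) []          _       = refl
  prefixOf-adjSwap-> zero    (suc (suc c)) (x ∷ [])    _       = refl
  prefixOf-adjSwap-> (suc a) (suc c)       []          _       = refl
  prefixOf-adjSwap-> (suc a) (suc c)       (x ∷ v)     (s≤s p) = cong (⁅ x ⁆ ∪_) (prefixOf-adjSwap-> a c v p)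
  prefixOf-adjSwap-> zero    (suc zero)    _           (s≤s ())

  prefixOf-adjSwap : ∀ a c (v : Vec (Fin n) k) → suc a < c ⊎ c ≤ a → prefixOf (adjSwap a v) c ≡ prefixOf v c
  prefixOf-adjSwap a c v (inj₁ p) = prefixOf-adjSwap-> a c v p
  prefixOf-adjSwap a c v (inj₂ p) = prefixOf-adjSwap-≤ a c v p

  prefixOf-cong : ∀ c (v : Vec (Fin n) k) (w : Vec (Fin n) k′) →
                  (∀ i → i < c → at i v ≡ at i w) → prefixOf v c ≡ prefixOf w c
  prefixOf-cong zero    v       w       h = refl
  prefixOf-cong (suc c) []      []      h = refl
  prefixOf-cong (suc c) []      (y ∷ w) h with () ← h zero (s≤s z≤n)
  prefixOf-cong (suc c) (x ∷ v) []      h with () ← h zero (s≤s z≤n)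
  prefixOf-cong (suc c) (x ∷ v) (y ∷ w) h with refl ← h zero (s≤s z≤n) =
    cong (⁅ x ⁆ ∪_) (prefixOf-cong c v w (λ i p → h (suc i) (s≤s p)))

  prefixOf-∷ʳ : ∀ c (v : Vec (Fin n) k) z → c ≤ k → prefixOf (v ∷ʳ z) c ≡ prefixOf v c
  prefixOf-∷ʳ zero    v       z _       = refl
  prefixOf-∷ʳ (suc c) (x ∷ v) z (s≤s p) = cong (⁅ x ⁆ ∪_) (prefixOf-∷ʳ c v z p)

  prefixOf-∌ : ∀ c {v : Vec (Fin n) k} {z} → All (_≢ z) v → lookup (prefixOf v c) z ≡ false
  prefixOf-∌ zero    {z = z} _          = lookup-∅ z
  prefixOf-∌ (suc c) {z = z} []         = lookup-∅ z
  prefixOf-∌ (suc c) {x ∷ v} (x≢z ∷ v∌z) = trans (lookup-⁅⁆∪-≢ (prefixOf v c) x≢z) (prefixOf-∌ c v∌z)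

  prefixOf-∌-adjPair : ∀ a {q : Vec (Fin n) k} {x y} → UniqueV q → adjPair a q ≡ just (x , y) →
                       lookup (prefixOf q a) x ≡ false × lookup (prefixOf q a) y ≡ false
  prefixOf-∌-adjPair zero    {x ∷ y ∷ w} _          refl = lookup-∅ x , lookup-∅ y
  prefixOf-∌-adjPair (suc a) {z ∷ w} (z∉w ∷ uw) e
    with z≢x , z≢y ← All-adjPair a z∉w e
       | x∉ , y∉ ← prefixOf-∌-adjPair a uw e =
    trans (lookup-⁅⁆∪-≢ (prefixOf w a) z≢x) x∉ , trans (lookup-⁅⁆∪-≢ (prefixOf w a) z≢y) y∉

module LastView where

  open import Data.Nat using (zero)
  open import Data.Fin using (Fin; zero; suc; fromℕ; inject₁)

  data LastView : {n : ℕ} → Fin (suc n) → Set where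
    isLast    : ∀ {n} → LastView (fromℕ n)
    isInject₁ : ∀ {n} (k : Fin n) → LastView (inject₁ k)

  lastView : ∀ {n} (x : Fin (suc n)) → LastView x
  lastView {zero}  zero    = isLast
  lastView {suc n} zero    = isInject₁ zero
  lastView {suc n} (suc x) with lastView x
  ... | isLast      = isLast
  ... | isInject₁ k = isInject₁ (suc k)

-- Rotating X(w₀) by one edge relabels k ↦ k+1 and n ↦ 1.  With labels in Fin (suc n₁)
-- this is σ, with inverse τ.
module Labels (n₁ : ℕ) where

  open import Data.Nat using (zero; _<_; s≤s)
  open import Data.Nat.Properties using (≤-pred; <-irrefl; <-≤-trans)
  open import Data.Bool using (Bool; true; false; not; _∨_)
  open import Data.Bool.Properties using (not-injective)
  open import Data.Fin using (Fin; zero; suc; fromℕ; inject₁; toℕ) renaming (_≟_ to _≟ᶠ_)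
  open import Data.Fin.Properties using (toℕ-inject₁; fromℕ≢inject₁; toℕ-fromℕ; toℕ<n)
  open import Data.Fin.Subset using (Subset; ⁅_⁆; _∪_)
  open import Data.Vec using (Vec; []; _∷_; map; lookup; tabulate)
  open import Data.Vec.Properties using (lookup∘tabulate)
  open import Data.Vec.Relation.Unary.All using (All)
  open import Data.Product using (_×_)
  open import Data.Empty using (⊥-elim)
  open import Function using (_∘′_)
  open import Relation.Nullary using (does; yes; no)
  open import Relation.Nullary.Decidable using (dec-true; dec-false)
  open import Relation.Binary.PropositionalEquality using (_≢_; refl; cong; cong₂; sym; trans; subst; module ≡-Reasoning)
  open ≡-Reasoning
  open Subsets
  open LastView

  N : ℕ
  N = suc n₁

  Lab : Set
  Lab = Fin N

  last : Lab
  last = fromℕ n₁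

  toℕ-last : toℕ last ≡ n₁
  toℕ-last = toℕ-fromℕ n₁

  toℕ≤n₁ : ∀ (z : Lab) → toℕ z ≤ n₁
  toℕ≤n₁ z = ≤-pred (toℕ<n z)

  <⇒≢last : ∀ {i j : Lab} → toℕ i < toℕ j → i ≢ last
  <⇒≢last {j = j} i<j refl = <-irrefl refl (<-≤-trans i<j (subst (toℕ j ≤_) (sym toℕ-last) (toℕ≤n₁ j)))

  NoLast : ∀ {k} → Vec Lab k → Set
  NoLast = All (_≢ last)

  Avoids : Subset N → Lab → Lab → Set
  Avoids S i j = lookup S i ≡ false × lookup S j ≡ false

  σ : ∀ {n} → Fin (suc n) → Fin (suc n)
  σ {zero}  zero    = zero
  σ {suc n} zero    = suc zero
  σ {suc n} (suc x) with σ {n} x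
  ... | zero  = zero
  ... | suc y = suc (suc y)

  σ-inject₁ : ∀ {n} (k : Fin n) → σ (inject₁ k) ≡ suc k
  σ-inject₁ {suc n} zero    = refl
  σ-inject₁ {suc n} (suc k) with σ (inject₁ k) | σ-inject₁ k
  ... | _ | refl = refl

  σ-last : ∀ {n} → σ (fromℕ n) ≡ zero
  σ-last {zero}  = refl
  σ-last {suc n} with σ (fromℕ n) | σ-last {n}
  ... | _ | refl = refl

  τ : Lab → Lab
  τ zero    = last
  τ (suc k) = inject₁ k

  τ∘σ : ∀ x → τ (σ x) ≡ x
  τ∘σ x with lastView x
  ... | isLast      = cong τ σ-last
  ... | isInject₁ k = cong τ (σ-inject₁ k)

  σ∘τ : ∀ x → σ (τ x) ≡ x
  σ∘τ zero    = σ-last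
  σ∘τ (suc k) = σ-inject₁ k

  toℕ-σ : ∀ x → x ≢ last → toℕ (σ x) ≡ suc (toℕ x)
  toℕ-σ x x≢last with lastView x
  ... | isLast      = ⊥-elim (x≢last refl)
  ... | isInject₁ k = trans (cong toℕ (σ-inject₁ k)) (cong suc (sym (toℕ-inject₁ k)))

  σ-mono : ∀ {x y} → x ≢ last → y ≢ last → toℕ x < toℕ y → toℕ (σ x) < toℕ (σ y)
  σ-mono {x} {y} x≢last y≢last x<y
    rewrite toℕ-σ x x≢last | toℕ-σ y y≢last = s≤s x<y

  does-σ≟ : ∀ x z → does (σ x ≟ᶠ z) ≡ does (x ≟ᶠ τ z)
  does-σ≟ x z with x ≟ᶠ τ z
  ... | yes refl = dec-true (σ (τ z) ≟ᶠ z) (σ∘τ z)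
  ... | no x≢τz  = dec-false (σ x ≟ᶠ z) (λ σx≡z → x≢τz (trans (sym (τ∘σ x)) (cong τ σx≡z)))

  lookup-⁅σ⁆ : ∀ x z → lookup ⁅ σ x ⁆ z ≡ lookup ⁅ x ⁆ (τ z)
  lookup-⁅σ⁆ x z = trans (lookup-⁅⁆ (σ x) z) (trans (does-σ≟ x z) (sym (lookup-⁅⁆ x (τ z))))

  σ-image : Subset N → Subset N
  σ-image S = tabulate (lookup S ∘′ τ)

  lookup-σ-image : ∀ S z → lookup (σ-image S) z ≡ lookup S (τ z)
  lookup-σ-image S = lookup∘tabulate _

  σ-image-injective : ∀ {S T} → σ-image S ≡ σ-image T → S ≡ T
  σ-image-injective {S} {T} e = lookup-extensionality λ z → begin
    lookup S z                ≡⟨ cong (lookup S) (τ∘σ z) ⟨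
    lookup S (τ (σ z))        ≡⟨ lookup-σ-image S (σ z) ⟨
    lookup (σ-image S) (σ z)  ≡⟨ cong (λ U → lookup U (σ z)) e ⟩
    lookup (σ-image T) (σ z)  ≡⟨ lookup-σ-image T (σ z) ⟩
    lookup T (τ (σ z))        ≡⟨ cong (lookup T) (τ∘σ z) ⟩
    lookup T z                ∎

  σ-image-prefixOf : ∀ {k} c (v : Vec Lab k) → σ-image (prefixOf v c) ≡ prefixOf (map σ v) c
  σ-image-prefixOf c v = lookup-extensionality (λ z → trans (lookup-σ-image (prefixOf v c) z) (sym (go c v z)))
    where
    go : ∀ {k} c (v : Vec Lab k) z → lookup (prefixOf (map σ v) c) z ≡ lookup (prefixOf v c) (τ z)
    go zero    v       z = trans (lookup-∅ z) (sym (lookup-∅ (τ z)))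
    go (suc c) []      z = trans (lookup-∅ z) (sym (lookup-∅ (τ z)))
    go (suc c) (x ∷ v) z = begin
      lookup (⁅ σ x ⁆ ∪ prefixOf (map σ v) c) z                ≡⟨ lookup-∪ ⁅ σ x ⁆ _ z ⟩
      lookup ⁅ σ x ⁆ z ∨ lookup (prefixOf (map σ v) c) z      ≡⟨ cong₂ _∨_ (lookup-⁅σ⁆ x z) (go c v z) ⟩
      lookup ⁅ x ⁆ (τ z) ∨ lookup (prefixOf v c) (τ z)        ≡⟨ lookup-∪ ⁅ x ⁆ _ (τ z) ⟨
      lookup (⁅ x ⁆ ∪ prefixOf v c) (τ z)                     ∎

  -- Rotation moves the top vertex of X(w₀) to the old vertex {n}.  A vertex S (the
  -- label set of a path from the top) becomes σ[S - n], plus the label 1 (= σ n) when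
  -- n ∉ S, since the path then starts by going back along the edge n.
  ρᵛ-bit : Subset N → Lab → Bool
  ρᵛ-bit S zero    = not (lookup S last)
  ρᵛ-bit S (suc k) = lookup S (inject₁ k)

  ρᵛ : Subset N → Subset N
  ρᵛ S = tabulate (ρᵛ-bit S)

  lookup-ρᵛ-suc : ∀ S k → lookup (ρᵛ S) (suc k) ≡ lookup S (inject₁ k)
  lookup-ρᵛ-suc S k = lookup∘tabulate (ρᵛ-bit S) (suc k)

  ρᵛ-injective : ∀ {S T} → ρᵛ S ≡ ρᵛ T → S ≡ T
  ρᵛ-injective {S} {T} e = lookup-extensionality h
    where
    h : ∀ z → lookup S z ≡ lookup T z
    h z with lastView z
    ... | isLast      = not-injective (cong (λ U → lookup U zero) e)
    ... | isInject₁ k = trans (sym (lookup-ρᵛ-suc S k)) (trans (cong (λ U → lookup U (suc k)) e) (lookup-ρᵛ-suc T k))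

  ρᵛ-prefixOf : ∀ {k} a {v : Vec Lab k} → NoLast v → ρᵛ (prefixOf v a) ≡ ⁅ zero ⁆ ∪ prefixOf (map σ v) a
  ρᵛ-prefixOf a {v} v∌last = lookup-extensionality h
    where
    h : ∀ z → lookup (ρᵛ (prefixOf v a)) z ≡ lookup (⁅ zero ⁆ ∪ prefixOf (map σ v) a) z
    h zero    = begin
      not (lookup (prefixOf v a) last)             ≡⟨ cong not (prefixOf-∌ a v∌last) ⟩
      true                                         ≡⟨ lookup-∪ ⁅ zero ⁆ (prefixOf (map σ v) a) zero ⟨
      lookup (⁅ zero ⁆ ∪ prefixOf (map σ v) a) zero ∎
    h (suc k) = begin
      lookup (ρᵛ (prefixOf v a)) (suc k)                  ≡⟨ lookup-ρᵛ-suc (prefixOf v a) k ⟩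
      lookup (prefixOf v a) (τ (suc k))                   ≡⟨ lookup-σ-image (prefixOf v a) (suc k) ⟨
      lookup (σ-image (prefixOf v a)) (suc k)             ≡⟨ cong (λ U → lookup U (suc k)) (σ-image-prefixOf a v) ⟩
      lookup (prefixOf (map σ v) a) (suc k)               ≡⟨ lookup-⁅⁆∪-≢ (prefixOf (map σ v) a) {zero} {suc k} (λ ()) ⟨
      lookup (⁅ zero ⁆ ∪ prefixOf (map σ v) a) (suc k)    ∎

  ρᵛ-⁅last⁆∪prefixOf : ∀ {k} a {v : Vec Lab k} → NoLast v → ρᵛ (⁅ last ⁆ ∪ prefixOf v a) ≡ prefixOf (map σ v) a
  ρᵛ-⁅last⁆∪prefixOf a {v} v∌last = lookup-extensionality h
    where
    P : Subset N
    P = prefixOf v a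
    h : ∀ z → lookup (ρᵛ (⁅ last ⁆ ∪ P)) z ≡ lookup (prefixOf (map σ v) a) z
    h zero    = begin
      not (lookup (⁅ last ⁆ ∪ P) last)         ≡⟨ cong not (lookup-⁅⁆∪-≡ P last) ⟩
      false                                    ≡⟨ prefixOf-∌ a v∌last ⟨
      lookup P last                            ≡⟨ lookup-σ-image P zero ⟨
      lookup (σ-image P) zero                  ≡⟨ cong (λ U → lookup U zero) (σ-image-prefixOf a v) ⟩
      lookup (prefixOf (map σ v) a) zero       ∎
    h (suc k) = begin
      lookup (ρᵛ (⁅ last ⁆ ∪ P)) (suc k)       ≡⟨ lookup-ρᵛ-suc (⁅ last ⁆ ∪ P) k ⟩
      lookup (⁅ last ⁆ ∪ P) (inject₁ k)        ≡⟨ lookup-⁅⁆∪-≢ P fromℕ≢inject₁ ⟩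
      lookup P (inject₁ k)                     ≡⟨ lookup-σ-image P (suc k) ⟨
      lookup (σ-image P) (suc k)               ≡⟨ cong (λ U → lookup U (suc k)) (σ-image-prefixOf a v) ⟩
      lookup (prefixOf (map σ v) a) (suc k)    ∎

-- Flips T Ok s q: flips at positions satisfying Ok turning the word s into q.  Unlike
-- Reach, which builds its table, every tile is checked against the fixed table T.
module Flips (n₁ : ℕ) where

  open import Data.Nat using (_<_)
  open import Data.Nat.Properties using (≤-refl; ≤-trans; <-trans; n<1+n; n≤1+n; <⇒≤; ≤-pred; <-cmp; <-irrefl; ≤-<-trans; <-≤-trans)
  open import Data.Fin using (Fin; suc; toℕ; inject₁)
  open import Data.Fin.Properties using (fromℕ≢inject₁)
  open import Data.Fin.Subset using (Subset)
  open import Data.Vec using (Vec; []; _∷_; map; lookup; allFin)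
  open import Data.Vec.Relation.Unary.All using (All; []; _∷_)
  open import Data.Vec.Relation.Unary.Unique.Propositional using () renaming (Unique to UniqueV)
  open import Data.Maybe using (just)
  open import Data.Maybe.Properties using (just-injective)
  open import Data.Product using (_,_; proj₁; proj₂)
  open import Data.Sum using (_⊎_; inj₁; inj₂)
  open import Data.Unit using (⊤; tt)
  open import Data.Empty using (⊥; ⊥-elim)
  open import Function using (_∘′_)
  open import Relation.Binary.Definitions using (tri<; tri≈; tri>)
  open import Relation.Binary.PropositionalEquality using (refl; cong; sym; trans; subst)
  open AllFin using (allFin-∷ʳ)
  open AdjacentPositions
  open Subsets
  open Labels n₁

  private variable
    k : ℕ

  entry : Tiling N → Lab → Lab → Subset N
  entry T x y = lookup (lookup T x) y

  data Flips {k} (T : Tiling N) (Ok : ℕ → Set) (s : Vec Lab k) : Vec Lab k → Set where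
    done : Flips T Ok s s
    step : ∀ {q x y} a → Flips T Ok s q → adjPair a q ≡ just (x , y) → toℕ x < toℕ y →
           entry T x y ≡ prefixOf q a → Ok a → Flips T Ok s (adjSwap a q)

  Anywhere : ℕ → Set
  Anywhere _ = ⊤

  Flips-++ : ∀ {T Ok} {s q r : Vec Lab k} → Flips T Ok s q → Flips T Ok q r → Flips T Ok s r
  Flips-++ c done                 = c
  Flips-++ c (step a d p x<y e o) = step a (Flips-++ c d) p x<y e o

  Flips-weaken : ∀ {T Ok Ok′} {s q : Vec Lab k} → (∀ {a} → Ok a → Ok′ a) → Flips T Ok s q → Flips T Ok′ s q
  Flips-weaken f done                 = done
  Flips-weaken f (step a c p x<y e o) = step a (Flips-weaken f c) p x<y e (f o)

  Flips-All : ∀ {T Ok} {P : Lab → Set} {s q : Vec Lab k} → Flips T Ok s q → All P s → All P q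
  Flips-All done                 h = h
  Flips-All (step a c _ _ _ _)   h = All-adjSwap a (Flips-All c h)

  Flips-Unique : ∀ {T Ok} {s q : Vec Lab k} → Flips T Ok s q → UniqueV s → UniqueV q
  Flips-Unique done                 us = us
  Flips-Unique (step a fl _ _ _ _)  us = Unique-adjSwap a (Flips-Unique fl us)

  at-Flips : ∀ {T Ok} {s q : Vec Lab k} i → (∀ {c} → Ok c → i < c ⊎ suc c < i) →
             Flips T Ok s q → at i q ≡ at i s
  at-Flips i h done                 = refl
  at-Flips i h (step a c _ _ _ o)   = trans (at-adjSwap i a _ (h o)) (at-Flips i h c)

  Flips-adjSwap : ∀ {T Ok} {s q : Vec Lab k} a → (∀ {c} → Ok c → Apart c a) →
                  Flips T Ok s q → Flips T Ok (adjSwap a s) (adjSwap a q)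
  Flips-adjSwap a h done = done
  Flips-adjSwap {T = T} {Ok} {s} a h (step {q = q} c ch p x<y e o) =
    subst (Flips T Ok (adjSwap a s)) (adjSwap-comm c a q (h o))
      (step c (Flips-adjSwap a h ch) (trans (adjPair-adjSwap c a q (h o)) p) x<y
            (trans e (sym (prefixOf-adjSwap a c q (apart (h o))))) o)
    where
    apart : Apart c a → suc a < c ⊎ c ≤ a
    apart (inj₁ c+1<a) = inj₂ (<⇒≤ (<-trans (n<1+n c) c+1<a))
    apart (inj₂ a+1<c) = inj₁ a+1<c

  identity : Vec Lab N
  identity = allFin N

  identityBelowLast : Vec Lab n₁
  identityBelowLast = map inject₁ (allFin n₁)

  NoLast-map-inject₁ : ∀ {k} (v : Vec (Fin n₁) k) → NoLast (map inject₁ v)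
  NoLast-map-inject₁ []      = []
  NoLast-map-inject₁ (x ∷ v) = (fromℕ≢inject₁ ∘′ sym) ∷ NoLast-map-inject₁ v

  -- The flips moving n from the end of the word insert γ to position r, past the
  -- letters γ[c] for r ≤ c < n₁, are all recorded in T.
  LastMovedTo : Tiling N → Vec Lab n₁ → ℕ → Set
  LastMovedTo T γ r = ∀ c → r ≤ c → ∀ x → adjPair c (insert (suc c) last γ) ≡ just (x , last) →
                      entry T x last ≡ prefixOf (insert (suc c) last γ) c

  -- Any flip sequence from the identity can be reordered so that n moves in one
  -- stretch: first flips among the other labels, then n travels left to position r,
  -- then flips to the right of n.
  record Normalised (T : Tiling N) (q : Vec Lab N) : Set where
    constructor normalised
    field
      γ        : Vec Lab n₁
      r        : ℕ
      r≤n₁     : r ≤ n₁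
      γ∌last   : NoLast γ
      before   : Flips T Anywhere identityBelowLast γ
      moveLast : LastMovedTo T γ r
      after    : Flips T (r <_) (insert r last γ) q

  module _ {T : Tiling N} {q : Vec Lab N} (nq : Normalised T q) {x y} a
           (pair : adjPair a q ≡ just (x , y)) (x<y : toℕ x < toℕ y)
           (tile : entry T x y ≡ prefixOf q a) where
    open Normalised nq

    private
      at-q : at a q ≡ just x × at (suc a) q ≡ just y
      at-q = adjPair⇒at a q pair

      at-q-≤r : ∀ i → i ≤ r → at i q ≡ at i (insert r last γ)
      at-q-≤r i i≤r = at-Flips i (λ r<c → inj₁ (≤-<-trans i≤r r<c)) after

      at-q-r : at r q ≡ just last
      at-q-r = trans (at-q-≤r r ≤-refl) (at-insert r last γ r≤n₁)

    a≢r : a ≡ r → ⊥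
    a≢r refl = <⇒≢last x<y (just-injective (trans (sym (proj₁ at-q)) at-q-r))

    normalised-right : r < a → Normalised T (adjSwap a q)
    normalised-right r<a = normalised γ r r≤n₁ γ∌last before moveLast (step a after pair x<y tile r<a)

    normalised-moveLast : suc a ≡ r → Normalised T (adjSwap a q)
    normalised-moveLast refl =
      normalised γ a (≤-trans (n≤1+n a) r≤n₁) γ∌last before moveLast′ after′
      where
      y≡last : y ≡ last
      y≡last = just-injective (trans (sym (proj₂ at-q)) at-q-r)
      moveLast′ : LastMovedTo T γ a
      moveLast′ c a≤c x′ e with <-cmp a c
      ... | tri< a<c _ _ = moveLast c a<c x′ e
      ... | tri> _ _ c<a = ⊥-elim (<-irrefl refl (<-≤-trans c<a a≤c))
      ... | tri≈ _ refl _ = subst (λ w → entry T w last ≡ prefixOf (insert (suc a) last γ) a) x≡x′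
        (trans (cong (entry T x) (sym y≡last))
          (trans tile (prefixOf-cong a q (insert (suc a) last γ) (λ i i<a → at-q-≤r i (<⇒≤ (<-trans i<a (n<1+n a)))))))
        where
        x≡x′ : x ≡ x′
        x≡x′ = just-injective (trans (sym (proj₁ at-q))
                 (trans (at-q-≤r a (n≤1+n a)) (proj₁ (adjPair⇒at a _ e))))
      after′ : Flips T (a <_) (insert a last γ) (adjSwap a q)
      after′ = subst (λ w → Flips T (a <_) w (adjSwap a q)) (adjSwap-insert-suc a last γ)
        (Flips-weaken (<-trans (n<1+n a)) (Flips-adjSwap a inj₂ after))

    normalised-left : suc a < r → Normalised T (adjSwap a q)
    normalised-left a+1<r =
      normalised (adjSwap a γ) r r≤n₁ (All-adjSwap a γ∌last) before′ moveLast′ after′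
      where
      a<r : a < r
      a<r = <-trans (n<1+n a) a+1<r
      at-γ : ∀ i → i < r → at i γ ≡ at i q
      at-γ i i<r = sym (trans (at-q-≤r i (<⇒≤ i<r)) (at-insert-< i r last γ i<r r≤n₁))
      pair-γ : adjPair a γ ≡ just (x , y)
      pair-γ = at⇒adjPair a γ (trans (at-γ a a<r) (proj₁ at-q)) (trans (at-γ (suc a) a+1<r) (proj₂ at-q))
      before′ : Flips T Anywhere identityBelowLast (adjSwap a γ)
      before′ = step a before pair-γ x<y
        (trans tile (prefixOf-cong a q γ (λ i i<a → sym (at-γ i (<-trans i<a a<r))))) tt
      moveLast′ : LastMovedTo T (adjSwap a γ) r
      moveLast′ c r≤c x′ e =
        trans (moveLast c r≤c x′ (trans (sym (adjPair-adjSwap c a V (inj₂ a+1<c))) (trans (cong (adjPair c) V≡) e)))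
                                   (trans (sym (prefixOf-adjSwap-> a c V a+1<c)) (cong (λ w → prefixOf w c) V≡))
        where
        V : Vec Lab N
        V = insert (suc c) last γ
        a+1<c : suc a < c
        a+1<c = <-≤-trans a+1<r r≤c
        V≡ : adjSwap a V ≡ insert (suc c) last (adjSwap a γ)
        V≡ = adjSwap-insert a (suc c) last γ (<-trans a+1<c (n<1+n c)) (≤-pred (adjPair-bound c _ e))
      after′ : Flips T (r <_) (insert r last (adjSwap a γ)) (adjSwap a q)
      after′ = subst (λ w → Flips T (r <_) w (adjSwap a q)) (adjSwap-insert a r last γ a+1<r r≤n₁)
        (Flips-adjSwap a (λ r<c → inj₂ (<-trans a+1<r r<c)) after)

  normalise : ∀ {T} {q : Vec Lab N} → Flips T Anywhere identity q → Normalised T q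
  normalise {T} done =
    normalised identityBelowLast n₁ ≤-refl (NoLast-map-inject₁ (allFin n₁)) done nothing-moved
      (subst (Flips T (n₁ <_) (insert n₁ last identityBelowLast)) (trans (insert-length last identityBelowLast) (sym (allFin-∷ʳ n₁))) done)
    where
    nothing-moved : LastMovedTo T identityBelowLast n₁
    nothing-moved c n₁≤c x e = ⊥-elim (<-irrefl refl (≤-<-trans n₁≤c (≤-pred (adjPair-bound c _ e))))
  normalise (step a ch pair x<y tile _) with nq ← normalise ch
    with <-cmp a (Normalised.r nq) | <-cmp (suc a) (Normalised.r nq)
  ... | tri> _ _ r<a | _              = normalised-right nq a pair x<y tile r<a
  ... | tri≈ _ a≡r _ | _              = ⊥-elim (a≢r nq a pair x<y tile a≡r)
  ... | tri< _ _ _   | tri< a+1<r _ _ = normalised-left nq a pair x<y tile a+1<r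
  ... | tri< _ _ _   | tri≈ _ a+1≡r _ = normalised-moveLast nq a pair x<y tile a+1≡r
  ... | tri< a<r _ _ | tri> _ _ r<a+1 = ⊥-elim (<-irrefl refl (<-≤-trans a<r (≤-pred r<a+1)))

module Rotation (n₁ : ℕ) where

  open import Data.Nat using (zero; _<_; _<ᵇ_; z≤n; s≤s)
  open import Data.Nat.Properties using (≤-refl; ≤-trans; <-trans; n<1+n; n≤1+n; <⇒≤; <⇒<ᵇ)
  open import Data.Bool using (if_then_else_)
  open import Data.Fin using (Fin; zero; suc; toℕ; inject₁)
  open import Data.Fin.Properties using (toℕ-inject₁)
  open import Data.Fin.Subset using (Subset) renaming (⊥ to ∅)
  open import Data.Vec using (Vec; _∷_; map; _∷ʳ_; lookup; tabulate; allFin; reverse)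
  open import Data.Vec.Properties using (lookup∘tabulate; map-∘; map-cong; map-∷ʳ; allFin-map; ∷-injective)
  open import Data.Maybe using (just)
  open import Data.Product using (_,_; proj₁; proj₂)
  open import Data.Sum using (inj₁)
  open import Data.Unit using (tt)
  open import Data.Empty using (⊥-elim)
  open import Relation.Binary.PropositionalEquality using (_≢_; refl; cong; sym; trans; subst; subst₂)
  open Booleans using (if-true)
  open AllFin using (reverse-allFin; reverse-allFin-∷ʳ)
  open AdjacentPositions
  open Subsets
  open LastView
  open Labels n₁
  open Flips n₁

  private variable
    k : ℕ

  -- A tile x < y < n with top S becomes the tile σx < σy with top ρᵛ S; a tile x < n
  -- with top S becomes the tile 1 < σx whose top is the old vertex S ∪ {n}, i.e.
  -- ρᵛ (S ∪ {n}) = σ[S].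
  ρ-entry : Tiling N → Lab → Lab → Subset N
  ρ-entry T zero    zero    = ∅
  ρ-entry T zero    (suc j) = σ-image (entry T (inject₁ j) last)
  ρ-entry T (suc i) zero    = ∅
  ρ-entry T (suc i) (suc j) = if toℕ i <ᵇ toℕ j then ρᵛ (entry T (inject₁ i) (inject₁ j)) else ∅

  ρ : Tiling N → Tiling N
  ρ T = tabulate (λ i → tabulate (ρ-entry T i))

  entry-ρ : ∀ T i j → entry (ρ T) i j ≡ ρ-entry T i j
  entry-ρ T i j = trans (cong (λ row → lookup row j) (lookup∘tabulate (λ i → tabulate (ρ-entry T i)) i))
                        (lookup∘tabulate (ρ-entry T i) j)

  entry-ρ-inject₁ : ∀ T (i j : Fin n₁) → toℕ i < toℕ j →
                    entry (ρ T) (suc i) (suc j) ≡ ρᵛ (entry T (inject₁ i) (inject₁ j))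
  entry-ρ-inject₁ T i j i<j = trans (entry-ρ T (suc i) (suc j)) (if-true (<⇒<ᵇ i<j))

  entry-ρ-σ : ∀ T {x y} → x ≢ last → y ≢ last → toℕ x < toℕ y →
              entry (ρ T) (σ x) (σ y) ≡ ρᵛ (entry T x y)
  entry-ρ-σ T {x} {y} x≢last y≢last x<y with lastView x | lastView y
  ... | isLast      | _           = ⊥-elim (x≢last refl)
  ... | _           | isLast      = ⊥-elim (y≢last refl)
  ... | isInject₁ i | isInject₁ j rewrite σ-inject₁ i | σ-inject₁ j =
    entry-ρ-inject₁ T i j (subst₂ _<_ (toℕ-inject₁ i) (toℕ-inject₁ j) x<y)

  entry-ρ-zero-σ : ∀ T {x} → x ≢ last → entry (ρ T) zero (σ x) ≡ σ-image (entry T x last)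
  entry-ρ-zero-σ T {x} x≢last with lastView x
  ... | isLast      = ⊥-elim (x≢last refl)
  ... | isInject₁ i rewrite σ-inject₁ i = entry-ρ T zero (suc i)

  -- Flips away from n are shifted one position right, behind the new first letter 1.
  Flips-ρ-before : ∀ {T} {γ : Vec Lab n₁} → Flips T Anywhere identityBelowLast γ →
                   Flips (ρ T) Anywhere (zero ∷ map σ identityBelowLast) (zero ∷ map σ γ)
  Flips-ρ-before done = done
  Flips-ρ-before {T} (step {q = q} {x} {y} a ch pair x<y tile _) =
    subst (Flips (ρ T) Anywhere (zero ∷ map σ identityBelowLast)) (cong (zero ∷_) (adjSwap-map σ a q))
      (step (suc a) (Flips-ρ-before ch) (adjPair-map σ a q pair) (σ-mono x≢last y≢last x<y)
        (trans (entry-ρ-σ T x≢last y≢last x<y) (trans (cong ρᵛ tile) (ρᵛ-prefixOf a q∌last))) tt)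
    where
    q∌last : NoLast q
    q∌last = Flips-All ch (NoLast-map-inject₁ (allFin n₁))
    x≢last : x ≢ last
    x≢last = proj₁ (All-adjPair a q∌last pair)
    y≢last : y ≢ last
    y≢last = proj₂ (All-adjPair a q∌last pair)

  -- The flips moving n to the front become the flips moving 1 to the back.
  Flips-ρ-moveLast : ∀ {T} {γ : Vec Lab n₁} → NoLast γ → LastMovedTo T γ 0 → ∀ c → c ≤ n₁ →
                     Flips (ρ T) Anywhere (map σ (insert 0 last γ)) (map σ (insert c last γ))
  Flips-ρ-moveLast γ∌last moved zero    _     = done
  Flips-ρ-moveLast {T} {γ} γ∌last moved (suc c) c<n₁ =
    subst (Flips (ρ T) Anywhere (map σ (insert 0 last γ))) end≡
      (step c (Flips-ρ-moveLast {T} γ∌last moved c (<⇒≤ c<n₁)) pair′ 0<σg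
        (trans (cong (λ w → entry (ρ T) w (σ g)) σ-last)
          (trans (entry-ρ-zero-σ T g≢last) (trans (cong σ-image tile) tile-prefix))) tt)
    where
    g : Lab
    g = proj₁ (at-bound⁻ c γ c<n₁)
    at-g : at c γ ≡ just g
    at-g = proj₂ (at-bound⁻ c γ c<n₁)
    g≢last : g ≢ last
    g≢last = All-at c γ∌last at-g
    0<σg : toℕ (σ last) < toℕ (σ g)
    0<σg = subst (λ w → toℕ w < toℕ (σ g)) (sym σ-last) (subst (0 <_) (sym (toℕ-σ g g≢last)) (s≤s z≤n))
    pair′ : adjPair c (map σ (insert c last γ)) ≡ just (σ last , σ g)
    pair′ = adjPair-map σ c _ (at⇒adjPair c _ (at-insert c last γ (<⇒≤ c<n₁)) (trans (at-suc-insert c last γ) at-g))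
    tile : entry T g last ≡ prefixOf (insert (suc c) last γ) c
    tile = moved c z≤n g (at⇒adjPair c _ (trans (at-insert-< c (suc c) last γ (n<1+n c) c<n₁) at-g) (at-insert (suc c) last γ c<n₁))
    tile-prefix : σ-image (prefixOf (insert (suc c) last γ) c) ≡ prefixOf (map σ (insert c last γ)) c
    tile-prefix = trans (cong σ-image (prefixOf-cong c _ _ λ i i<c →
        trans (at-insert-< i (suc c) last γ (<-trans i<c (n<1+n c)) c<n₁) (sym (at-insert-< i c last γ i<c (<⇒≤ c<n₁)))))
      (σ-image-prefixOf c (insert c last γ))
    end≡ : adjSwap c (map σ (insert c last γ)) ≡ map σ (insert (suc c) last γ)
    end≡ = trans (adjSwap-map σ c _)
      (cong (map σ) (trans (cong (adjSwap c) (sym (adjSwap-insert-suc c last γ))) (adjSwap-involutive c _)))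

  record FlipsFromLastFirst (T : Tiling N) (γ : Vec Lab n₁) (q : Vec Lab N) : Set where
    constructor flipsFromLastFirst
    field
      β      : Vec Lab n₁
      q≡     : q ≡ last ∷ β
      β∌last : NoLast β
      flips  : Flips (ρ T) Anywhere (map σ γ ∷ʳ zero) (map σ β ∷ʳ zero)

  -- Flips behind n (now at the front) are shifted one position left, in front of 1.
  Flips-ρ-after : ∀ {T} {γ : Vec Lab n₁} {q} → NoLast γ → Flips T (0 <_) (last ∷ γ) q → FlipsFromLastFirst T γ q
  Flips-ρ-after {γ = γ} γ∌last done = flipsFromLastFirst γ refl γ∌last done
  Flips-ρ-after {T} {γ} γ∌last (step {x = x} {y} (suc a) ch pair x<y tile _)
    with flipsFromLastFirst β refl β∌last flips ← Flips-ρ-after γ∌last ch =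
    flipsFromLastFirst (adjSwap a β) refl (All-adjSwap a β∌last)
      (subst (Flips (ρ T) Anywhere (map σ γ ∷ʳ zero)) end≡
        (step a flips (adjPair-∷ʳ a _ zero (adjPair-map σ a β pair)) (σ-mono x≢last y≢last x<y)
          (trans (entry-ρ-σ T x≢last y≢last x<y)
            (trans (cong ρᵛ tile) (trans (ρᵛ-⁅last⁆∪prefixOf a β∌last)
              (sym (prefixOf-∷ʳ a (map σ β) zero (≤-trans (n≤1+n a) (<⇒≤ (adjPair-bound a β pair)))))))) tt))
    where
    x≢last : x ≢ last
    x≢last = proj₁ (All-adjPair a β∌last pair)
    y≢last : y ≢ last
    y≢last = proj₂ (All-adjPair a β∌last pair)
    end≡ : adjSwap a (map σ β ∷ʳ zero) ≡ map σ (adjSwap a β) ∷ʳ zero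
    end≡ = trans (adjSwap-∷ʳ a (map σ β) zero (adjPair-map σ a β pair)) (cong (_∷ʳ zero) (adjSwap-map σ a β))

  reversal : Vec Lab N
  reversal = reverse (allFin N)

  map-σ-inject₁ : ∀ {m} (w : Vec (Fin n₁) m) → map σ (map inject₁ w) ≡ map suc w
  map-σ-inject₁ w = trans (sym (map-∘ σ inject₁ w)) (map-cong σ-inject₁ w)

  Flips-ρ : ∀ {T} → Flips T Anywhere identity reversal → Flips (ρ T) Anywhere identity reversal
  Flips-ρ {T} fl with normalise fl
  ... | normalised γ (suc r) r≤n₁ γ∌last before moved after =
    ⊥-elim (All-at r (NoLast-map-inject₁ (reverse (allFin n₁))) last-inside refl)
    where
    last-inside : at r (map inject₁ (reverse (allFin n₁))) ≡ just last
    last-inside = trans (sym (cong (at (suc r)) (reverse-allFin n₁)))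
      (trans (at-Flips (suc r) inj₁ after) (at-insert (suc r) last γ r≤n₁))
  ... | normalised γ zero _ γ∌last before moved after
    with flipsFromLastFirst β q≡ _ flips ← Flips-ρ-after γ∌last after =
    subst₂ (Flips (ρ T) Anywhere) start≡ end≡
      (Flips-++ (Flips-ρ-before before)
        (Flips-++ (subst₂ (Flips (ρ T) Anywhere) front≡ back≡ (Flips-ρ-moveLast {T} γ∌last moved n₁ ≤-refl)) flips))
    where
    front≡ : map σ (insert 0 last γ) ≡ zero ∷ map σ γ
    front≡ = cong (_∷ map σ γ) σ-last
    back≡ : map σ (insert n₁ last γ) ≡ map σ γ ∷ʳ zero
    back≡ = trans (cong (map σ) (insert-length last γ)) (trans (map-∷ʳ σ last γ) (cong (map σ γ ∷ʳ_) σ-last))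
    start≡ : zero ∷ map σ identityBelowLast ≡ identity
    start≡ = trans (cong (zero ∷_) (map-σ-inject₁ (allFin n₁))) (sym (allFin-map n₁))
    β≡ : β ≡ map inject₁ (reverse (allFin n₁))
    β≡ = proj₂ (∷-injective (trans (sym q≡) (reverse-allFin n₁)))
    end≡ : map σ β ∷ʳ zero ≡ reversal
    end≡ = trans (cong (λ w → map σ w ∷ʳ zero) β≡)
      (trans (cong (_∷ʳ zero) (map-σ-inject₁ (reverse (allFin n₁)))) (sym (reverse-allFin-∷ʳ n₁)))

module FlipsAndReach (n₁ : ℕ) where

  open import Data.Nat using (zero; _<_; _<ᵇ_; s≤s)
  open import Data.Nat.Properties using (suc-injective; <-irrefl; <-trans)
  open import Data.Bool using (Bool; true; false; if_then_else_; _∧_)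
  open import Data.Fin using (Fin; zero; suc; toℕ) renaming (_≟_ to _≟ᶠ_)
  open import Data.Fin.Properties using () renaming (<⇒≢ to <⇒≢ᶠ)
  open import Data.Fin.Subset using (Subset) renaming (⊥ to ∅)
  open import Data.Vec using (Vec; []; _∷_; map; _∷ʳ_; lookup; tabulate; allFin; reverse; _[_]≔_)
  open import Data.Vec.Properties using (lookup∘tabulate; lookup-replicate; lookup∘update; lookup∘update′; allFin-map)
  open import Data.Vec.Relation.Unary.Any using (here; there)
  open import Data.Vec.Relation.Unary.All using (All; []; _∷_)
  open import Data.Vec.Relation.Unary.AllPairs using (_∷_)
  open import Data.Vec.Relation.Unary.Unique.Propositional using () renaming (Unique to UniqueV)
  open import Data.Vec.Membership.Propositional using () renaming (_∈_ to _∈ᵛ_)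
  open import Data.Vec.Membership.Propositional.Properties using (∈-map⁺)
  open import Data.Maybe using (just)
  open import Data.Product using (_,_; proj₁; proj₂)
  open import Data.Unit using (tt)
  open import Data.Empty using (⊥-elim)
  open import Function using (_∘′_)
  open import Relation.Nullary using (does; yes; no; ¬_)
  open import Relation.Nullary.Decidable using (dec-true; dec-false; _×-dec_)
  open import Relation.Binary.PropositionalEquality using (_≢_; refl; cong; sym; trans; subst; module ≡-Reasoning)
  open Booleans using (<⇒<ᵇ≡true; <ᵇ≡true⇒<)
  open AllFin using (reverse-allFin-∷ʳ; Unique-allFin)
  open AdjacentPositions
  open Subsets
  open Labels n₁
  open Flips n₁
  open Rotation n₁ using (reversal)

  private variable
    A : Set
    k : ℕ

  swapAt≡adjSwap : ∀ (p : Vec A k) (a b : Fin k) → toℕ b ≡ suc (toℕ a) →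
                   (p [ a ]≔ lookup p b) [ b ]≔ lookup p a ≡ adjSwap (toℕ a) p
  swapAt≡adjSwap (x ∷ y ∷ w) zero    (suc zero)    refl = refl
  swapAt≡adjSwap (x ∷ w)     (suc a) (suc b)       e    = cong (x ∷_) (swapAt≡adjSwap w a b (suc-injective e))
  swapAt≡adjSwap (x ∷ w)     zero    (suc (suc b)) ()

  adjPair≡lookup : ∀ (p : Vec A k) (a b : Fin k) → toℕ b ≡ suc (toℕ a) →
                   adjPair (toℕ a) p ≡ just (lookup p a , lookup p b)
  adjPair≡lookup (x ∷ y ∷ w) zero    (suc zero)    refl = refl
  adjPair≡lookup (x ∷ w)     (suc a) (suc b)       e    = adjPair≡lookup w a b (suc-injective e)
  adjPair≡lookup (x ∷ w)     zero    (suc (suc b)) ()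

  record AdjacentIndices (p : Vec A k) (a : ℕ) (x y : A) : Set where
    constructor adjacentIndices
    field
      i j    : Fin k
      toℕi   : toℕ i ≡ a
      toℕj   : toℕ j ≡ suc (toℕ i)
      p[i]≡x : lookup p i ≡ x
      p[j]≡y : lookup p j ≡ y

  adjPair⇒indices : ∀ (p : Vec A k) a {x y} → adjPair a p ≡ just (x , y) → AdjacentIndices p a x y
  adjPair⇒indices (x ∷ y ∷ w) zero    refl = adjacentIndices zero (suc zero) refl refl refl refl
  adjPair⇒indices (z ∷ w)     (suc a) e
    with adjacentIndices i j refl j≡ refl refl ← adjPair⇒indices w a e =
    adjacentIndices (suc i) (suc j) refl (cong suc j≡) refl refl

  Reach-step : ∀ {q : Vec Lab N} {t x y} → Reach N q t → ∀ a → adjPair a q ≡ just (x , y) → toℕ x < toℕ y →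
               Reach N (adjSwap a q) (addTile t x y (prefixOf q a))
  Reach-step {q} r a pair x<y with adjacentIndices i j refl j≡ refl refl ← adjPair⇒indices q a pair =
    subst (λ w → Reach N w (addTile _ (lookup q i) (lookup q j) (prefixOf q (toℕ i))))
          (swapAt≡adjSwap q i j j≡) (flip r i j j≡ x<y)

  precedes : ∀ {n} → Fin n → Fin n → Vec (Fin n) k → Bool
  precedes y x []      = false
  precedes y x (z ∷ v) = if does (z ≟ᶠ y) then true else (if does (z ≟ᶠ x) then false else precedes y x v)

  precedes-skip : ∀ {n} {y x z : Fin n} (v : Vec (Fin n) k) → z ≢ y → z ≢ x → precedes y x (z ∷ v) ≡ precedes y x v
  precedes-skip {y = y} {x} {z} v z≢y z≢x rewrite dec-false (z ≟ᶠ y) z≢y | dec-false (z ≟ᶠ x) z≢x = refl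

  ≟-refl-true : ∀ {n} (x : Fin n) → does (x ≟ᶠ x) ≡ true
  ≟-refl-true x = dec-true (x ≟ᶠ x) refl

  precedes-before-flip : ∀ a {q : Vec Lab k} {x y} → UniqueV q → adjPair a q ≡ just (x , y) → x ≢ y →
                         precedes y x q ≡ false
  precedes-before-flip zero    {x ∷ y ∷ w} _          refl x≢y
    rewrite dec-false (x ≟ᶠ y) x≢y | ≟-refl-true x = refl
  precedes-before-flip (suc a) {z ∷ w}     (z∉w ∷ uw) e    x≢y =
    trans (precedes-skip w (proj₂ (All-adjPair a z∉w e)) (proj₁ (All-adjPair a z∉w e)))
          (precedes-before-flip a uw e x≢y)

  precedes-after-flip : ∀ a {q : Vec Lab k} {x y} → UniqueV q → adjPair a q ≡ just (x , y) →
                        precedes y x (adjSwap a q) ≡ true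
  precedes-after-flip zero    {x ∷ y ∷ w} _          refl rewrite ≟-refl-true y = refl
  precedes-after-flip (suc a) {z ∷ w}     (z∉w ∷ uw) e    =
    trans (precedes-skip (adjSwap a w) (proj₂ (All-adjPair a z∉w e)) (proj₁ (All-adjPair a z∉w e)))
          (precedes-after-flip a uw e)

  precedes-flip-other : ∀ a (q : Vec Lab k) {x y i j} → adjPair a q ≡ just (x , y) → toℕ x < toℕ y → toℕ i < toℕ j →
                        ¬ (i ≡ x × j ≡ y) → precedes j i (adjSwap a q) ≡ precedes j i q
  precedes-flip-other (suc a) (z ∷ w) {i = i} {j} e x<y i<j ¬xy with z ≟ᶠ j | z ≟ᶠ i
  ... | yes _ | _     = refl
  ... | no _  | yes _ = refl
  ... | no _  | no _  = precedes-flip-other a w e x<y i<j ¬xy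
  precedes-flip-other zero (x ∷ y ∷ w) {i = i} {j} refl x<y i<j ¬xy
    with y ≟ᶠ j | x ≟ᶠ j | y ≟ᶠ i | x ≟ᶠ i
  ... | yes refl | yes refl | _        | _        = ⊥-elim (<⇒≢ᶠ x<y refl)
  ... | yes refl | no _     | _        | yes refl = ⊥-elim (¬xy (refl , refl))
  ... | yes refl | no _     | _        | no _     = refl
  ... | no _     | yes refl | yes refl | _        = ⊥-elim (<-irrefl refl (<-trans x<y i<j))
  ... | no _     | yes refl | no _     | _        = refl
  ... | no _     | no _     | yes refl | yes refl = ⊥-elim (<⇒≢ᶠ x<y refl)
  ... | no _     | no _     | yes refl | no _     = refl
  ... | no _     | no _     | no _     | yes refl = refl
  ... | no _     | no _     | no _     | no _     = refl

  precedes-map-suc : ∀ {n} (j i : Fin n) (v : Vec (Fin n) k) → precedes (suc j) (suc i) (map suc v) ≡ precedes j i v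
  precedes-map-suc j i []      = refl
  precedes-map-suc j i (z ∷ v) with does (z ≟ᶠ j) | does (z ≟ᶠ i)
  ... | true  | _     = refl
  ... | false | true  = refl
  ... | false | false = precedes-map-suc j i v

  precedes-∷ʳ : ∀ {n} (j i : Fin n) (v : Vec (Fin n) k) z → precedes j i v ≡ true → precedes j i (v ∷ʳ z) ≡ true
  precedes-∷ʳ j i (x ∷ v) z e with does (x ≟ᶠ j) | does (x ≟ᶠ i)
  ... | true  | _     = refl
  ... | false | false = precedes-∷ʳ j i v z e

  precedes-∷ʳ-∈ : ∀ {n} (j i : Fin n) (v : Vec (Fin n) k) → j ∈ᵛ v → (∀ {z} → z ∈ᵛ v → z ≢ i) →
                  precedes j i (v ∷ʳ i) ≡ true
  precedes-∷ʳ-∈ j i (x ∷ v) (here refl) v∌i rewrite ≟-refl-true x = refl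
  precedes-∷ʳ-∈ j i (x ∷ v) (there j∈v) v∌i with does (x ≟ᶠ j)
  ... | true  = refl
  ... | false rewrite dec-false (x ≟ᶠ i) (v∌i (here refl)) = precedes-∷ʳ-∈ j i v j∈v (v∌i ∘′ there)

  precedes-identity : ∀ n (i j : Fin n) → toℕ i < toℕ j → precedes j i (allFin n) ≡ false
  precedes-identity (suc n) i j i<j = subst (λ v → precedes j i v ≡ false) (sym (allFin-map n)) (go i j i<j)
    where
    go : ∀ (i j : Fin (suc n)) → toℕ i < toℕ j → precedes j i (zero ∷ map suc (allFin n)) ≡ false
    go zero    (suc j) _         = refl
    go (suc i) (suc j) (s≤s i<j) = trans (precedes-map-suc j i (allFin n)) (precedes-identity n i j i<j)

  ∈-reverse-allFin : ∀ n (x : Fin n) → x ∈ᵛ reverse (allFin n)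
  ∈-reverse-allFin (suc n) x rewrite reverse-allFin-∷ʳ n with x
  ... | zero  = ∈-∷ʳ (map suc (reverse (allFin n)))
    where
    ∈-∷ʳ : ∀ {k} (v : Vec (Fin (suc n)) k) → zero ∈ᵛ (v ∷ʳ zero)
    ∈-∷ʳ []      = here refl
    ∈-∷ʳ (y ∷ v) = there (∈-∷ʳ v)
  ... | suc y = ∈-∷ʳ⁺ (∈-map⁺ suc (∈-reverse-allFin n y))
    where
    ∈-∷ʳ⁺ : ∀ {k} {v : Vec (Fin (suc n)) k} {w} → w ∈ᵛ v → w ∈ᵛ (v ∷ʳ zero)
    ∈-∷ʳ⁺ (here e)  = here e
    ∈-∷ʳ⁺ (there p) = there (∈-∷ʳ⁺ p)

  precedes-reversal : ∀ n (i j : Fin n) → toℕ i < toℕ j → precedes j i (reverse (allFin n)) ≡ true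
  precedes-reversal (suc n) i j i<j =
    subst (λ v → precedes j i v ≡ true) (sym (reverse-allFin-∷ʳ n)) (go i j i<j)
    where
    R : Vec (Fin n) n
    R = reverse (allFin n)
    suc≢zero : ∀ {k} {v : Vec (Fin n) k} {z : Fin (suc n)} → z ∈ᵛ map suc v → z ≢ zero
    suc≢zero {v = _ ∷ _} (here refl) ()
    suc≢zero {v = _ ∷ _} (there p)   = suc≢zero p
    go : ∀ (i j : Fin (suc n)) → toℕ i < toℕ j → precedes j i (map suc R ∷ʳ zero) ≡ true
    go zero    (suc j) _         =
      precedes-∷ʳ-∈ (suc j) zero (map suc R) (∈-map⁺ suc (∈-reverse-allFin n j)) suc≢zero
    go (suc i) (suc j) (s≤s i<j) =
      precedes-∷ʳ (suc j) (suc i) (map suc R) zero (trans (precedes-map-suc j i R) (precedes-reversal n i j i<j))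

  inverted : Vec Lab N → Lab → Lab → Bool
  inverted q i j = (toℕ i <ᵇ toℕ j) ∧ precedes j i q

  _↾_ : Tiling N → Vec Lab N → Tiling N
  T ↾ q = tabulate (λ i → tabulate (λ j → if inverted q i j then entry T i j else ∅))

  entry-↾ : ∀ T q i j → entry (T ↾ q) i j ≡ (if inverted q i j then entry T i j else ∅)
  entry-↾ T q i j =
    trans (cong (λ row → lookup row j) (lookup∘tabulate (λ i → tabulate (λ j → if inverted q i j then entry T i j else ∅)) i))
                          (lookup∘tabulate (λ j → if inverted q i j then entry T i j else ∅) j)

  inverted-identity : ∀ i j → inverted identity i j ≡ false
  inverted-identity i j with toℕ i <ᵇ toℕ j in i<ᵇj
  ... | false = refl
  ... | true  = precedes-identity N i j (<ᵇ≡true⇒< i<ᵇj)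

  inverted-reversal : ∀ {i j} → toℕ i < toℕ j → inverted reversal i j ≡ true
  inverted-reversal {i} {j} i<j rewrite <⇒<ᵇ≡true i<j = precedes-reversal N i j i<j

  inverted-≮ : ∀ {q i j} → ¬ (toℕ i < toℕ j) → inverted q i j ≡ false
  inverted-≮ {i = i} {j} i≮j with toℕ i <ᵇ toℕ j in i<ᵇj
  ... | false = refl
  ... | true  = ⊥-elim (i≮j (<ᵇ≡true⇒< i<ᵇj))

  inverted-flip : ∀ a {q x y} → UniqueV q → adjPair a q ≡ just (x , y) → toℕ x < toℕ y →
                  inverted (adjSwap a q) x y ≡ true
  inverted-flip a uq pair x<y rewrite <⇒<ᵇ≡true x<y = precedes-after-flip a uq pair

  inverted-flip-other : ∀ a {q x y} i j → adjPair a q ≡ just (x , y) → toℕ x < toℕ y → ¬ (i ≡ x × j ≡ y) →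
                        inverted (adjSwap a q) i j ≡ inverted q i j
  inverted-flip-other a {q} i j pair x<y ¬xy with toℕ i <ᵇ toℕ j in i<ᵇj
  ... | false = refl
  ... | true  = precedes-flip-other a q pair x<y (<ᵇ≡true⇒< i<ᵇj) ¬xy

  entry-addTile : ∀ t x y S → entry (addTile t x y S) x y ≡ S
  entry-addTile t x y S = trans (cong (λ row → lookup row y) (lookup∘update x t _)) (lookup∘update y (lookup t x) S)

  entry-addTile-other : ∀ t {x y} S i j → ¬ (i ≡ x × j ≡ y) → entry (addTile t x y S) i j ≡ entry t i j
  entry-addTile-other t {x} {y} S i j ¬xy with i ≟ᶠ x | j ≟ᶠ y
  ... | yes refl | yes refl = ⊥-elim (¬xy (refl , refl))
  ... | yes refl | no j≢y   = trans (cong (λ row → lookup row j) (lookup∘update x t _)) (lookup∘update′ j≢y (lookup t x) S)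
  ... | no i≢x   | _        = cong (λ row → lookup row j) (lookup∘update′ i≢x t _)

  entry-emptyTiling : ∀ i j → entry (emptyTiling {N}) i j ≡ ∅
  entry-emptyTiling i j = trans (cong (λ row → lookup row j) (lookup-replicate i _)) (lookup-replicate j ∅)

  tiling-extensionality : ∀ {S T : Tiling N} → (∀ i j → entry S i j ≡ entry T i j) → S ≡ T
  tiling-extensionality h = lookup-extensionality (λ i → lookup-extensionality (h i))

  Flips⇒Reach : ∀ {T Ok} {q : Vec Lab N} → Flips T Ok identity q → Reach N q (T ↾ q)
  Flips⇒Reach {T} done = subst (Reach N identity) (tiling-extensionality h) start
    where
    h : ∀ i j → entry emptyTiling i j ≡ entry (T ↾ identity) i j
    h i j = trans (entry-emptyTiling i j)
      (sym (trans (entry-↾ T identity i j) (cong (λ b → if b then entry T i j else ∅) (inverted-identity i j))))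
  Flips⇒Reach {T} (step {q = q} {x} {y} a fl pair x<y tile _) =
    subst (Reach N (adjSwap a q)) (tiling-extensionality h) (Reach-step (Flips⇒Reach fl) a pair x<y)
    where
    h : ∀ i j → entry (addTile (T ↾ q) x y (prefixOf q a)) i j ≡ entry (T ↾ adjSwap a q) i j
    h i j with (i ≟ᶠ x) ×-dec (j ≟ᶠ y)
    ... | yes (refl , refl) = begin
      entry (addTile (T ↾ q) x y (prefixOf q a)) x y ≡⟨ entry-addTile (T ↾ q) x y _ ⟩
      prefixOf q a                                   ≡⟨ tile ⟨
      entry T x y                                    ≡⟨ cong (λ b → if b then entry T x y else ∅) (inverted-flip a uq pair x<y) ⟨
      (if inverted (adjSwap a q) x y then entry T x y else ∅) ≡⟨ entry-↾ T (adjSwap a q) x y ⟨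
      entry (T ↾ adjSwap a q) x y                    ∎
      where
      open ≡-Reasoning
      uq : UniqueV q
      uq = Flips-Unique fl (Unique-allFin N)
    ... | no ¬xy = begin
      entry (addTile (T ↾ q) x y (prefixOf q a)) i j ≡⟨ entry-addTile-other (T ↾ q) _ i j ¬xy ⟩
      entry (T ↾ q) i j                              ≡⟨ entry-↾ T q i j ⟩
      (if inverted q i j then entry T i j else ∅)
        ≡⟨ cong (λ b → if b then entry T i j else ∅) (inverted-flip-other a i j pair x<y ¬xy) ⟨
      (if inverted (adjSwap a q) i j then entry T i j else ∅) ≡⟨ entry-↾ T (adjSwap a q) i j ⟨
      entry (T ↾ adjSwap a q) i j                    ∎
      where open ≡-Reasoning

  Flips-retabulate : ∀ {T T′ Ok} {s q : Vec Lab k} → Flips T Ok s q → UniqueV s →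
                     (∀ x y → toℕ x < toℕ y → precedes y x q ≡ true → entry T′ x y ≡ entry T x y) → Flips T′ Ok s q
  Flips-retabulate done _ _ = done
  Flips-retabulate {T = T} {T′} (step {q = q} {x} {y} a fl pair x<y tile o) us agree =
    step a (Flips-retabulate fl us agree′) pair x<y (trans (agree x y x<y (precedes-after-flip a uq pair)) tile) o
    where
    uq : UniqueV q
    uq = Flips-Unique fl us
    agree′ : ∀ i j → toℕ i < toℕ j → precedes j i q ≡ true → entry T′ i j ≡ entry T i j
    agree′ i j i<j p with (i ≟ᶠ x) ×-dec (j ≟ᶠ y)
    ... | yes (refl , refl) = agree x y x<y (precedes-after-flip a uq pair)
    ... | no ¬xy            = agree i j i<j (trans (precedes-flip-other a q pair x<y i<j ¬xy) p)

  Reach⇒Flips : ∀ {p : Vec Lab N} {t} → Reach N p t → UniqueV p × Flips t Anywhere identity p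
  Reach⇒Flips start = Unique-allFin N , done
  Reach⇒Flips (flip {p = p} {t = t} r i j j≡ x<y) with up , fl ← Reach⇒Flips r =
    subst UniqueV (sym swap≡) (Unique-adjSwap (toℕ i) up) ,
    subst (Flips t′ Anywhere identity) (sym swap≡)
      (step (toℕ i) (Flips-retabulate fl (Unique-allFin N) agree) pair x<y (entry-addTile t x y S) tt)
    where
    x y : Lab
    x = lookup p i
    y = lookup p j
    S : Subset N
    S = prefixOf p (toℕ i)
    t′ : Tiling N
    t′ = addTile t x y S
    swap≡ : swapAt p i j ≡ adjSwap (toℕ i) p
    swap≡ = swapAt≡adjSwap p i j j≡
    pair : adjPair (toℕ i) p ≡ just (x , y)
    pair = adjPair≡lookup p i j j≡
    agree : ∀ x′ y′ → toℕ x′ < toℕ y′ → precedes y′ x′ p ≡ true → entry t′ x′ y′ ≡ entry t x′ y′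
    agree x′ y′ _ p′ = entry-addTile-other t S x′ y′ λ { (refl , refl) →
      true≢false (trans (sym p′) (precedes-before-flip (toℕ i) up pair (<⇒≢ᶠ x<y))) }
      where
      true≢false : true ≢ false
      true≢false ()

module RotatedTilings (n₁ : ℕ) where

  open import Data.Nat using (zero; _<_; _<ᵇ_; _<?_; z≤n; s≤s)
  open import Data.Bool using (Bool; true; false; if_then_else_)
  open import Data.Fin using (Fin; zero; suc; toℕ; inject₁) renaming (_≟_ to _≟ᶠ_)
  open import Data.Fin.Properties using (toℕ-inject₁)
  open import Data.Fin.Subset using (Subset) renaming (⊥ to ∅)
  open import Data.Vec using (Vec; lookup)
  open import Data.Product using (_,_; proj₁; proj₂)
  open import Data.Empty using (⊥-elim)
  open import Relation.Nullary using (yes; no; ¬_)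
  open import Relation.Nullary.Decidable using (_×-dec_)
  open import Relation.Binary.PropositionalEquality using (refl; cong; sym; trans; subst; subst₂)
  open Booleans using (<ᵇ≡true⇒<)
  open Subsets
  open LastView
  open Labels n₁
  open Flips n₁
  open Rotation n₁
  open FlipsAndReach n₁

  UpperTriangular : Tiling N → Set
  UpperTriangular t = ∀ i j → ¬ (toℕ i < toℕ j) → entry t i j ≡ ∅

  WellLabelled : Tiling N → Set
  WellLabelled t = ∀ i j → Avoids (entry t i j) i j

  Reach⇒UpperTriangular : ∀ {p t} → Reach N p t → UpperTriangular t
  Reach⇒UpperTriangular start                   i j _   = entry-emptyTiling i j
  Reach⇒UpperTriangular (flip {t = t} r a b _ x<y) i j i≮j =
    trans (entry-addTile-other t _ i j λ { (refl , refl) → i≮j x<y }) (Reach⇒UpperTriangular r i j i≮j)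

  Reach⇒WellLabelled : ∀ {p t} → Reach N p t → WellLabelled t
  Reach⇒WellLabelled start i j =
    trans (cong (λ S → lookup S i) (entry-emptyTiling i j)) (lookup-∅ i) ,
    trans (cong (λ S → lookup S j) (entry-emptyTiling i j)) (lookup-∅ j)
  Reach⇒WellLabelled (flip {p = p} {t = t} r a b b≡ _) i j
    with (i ≟ᶠ lookup p a) ×-dec (j ≟ᶠ lookup p b)
  ... | yes (refl , refl) rewrite entry-addTile t i j (prefixOf p (toℕ a)) =
    prefixOf-∌-adjPair (toℕ a) (proj₁ (Reach⇒Flips r)) (adjPair≡lookup p a b b≡)
  ... | no ¬ab rewrite entry-addTile-other t (prefixOf p (toℕ a)) i j ¬ab = Reach⇒WellLabelled r i j

  UpperTriangular-ρ : ∀ T → UpperTriangular (ρ T)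
  UpperTriangular-ρ T zero    zero    _   = entry-ρ T zero zero
  UpperTriangular-ρ T zero    (suc j) i≮j = ⊥-elim (i≮j (s≤s z≤n))
  UpperTriangular-ρ T (suc i) zero    _   = entry-ρ T (suc i) zero
  UpperTriangular-ρ T (suc i) (suc j) i≮j with toℕ i <ᵇ toℕ j in i<ᵇj
  ... | true  = ⊥-elim (i≮j (s≤s (<ᵇ≡true⇒< i<ᵇj)))
  ... | false = trans (entry-ρ T (suc i) (suc j)) (cong (λ b → if b then ρᵛ (entry T (inject₁ i) (inject₁ j)) else ∅) i<ᵇj)

  ↾-reversal : ∀ T → UpperTriangular T → T ↾ reversal ≡ T
  ↾-reversal T ut = tiling-extensionality h
    where
    h : ∀ i j → entry (T ↾ reversal) i j ≡ entry T i j
    h i j with toℕ i <? toℕ j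
    ... | yes i<j = trans (entry-↾ T reversal i j) (cong (λ b → if b then entry T i j else ∅) (inverted-reversal i<j))
    ... | no i≮j  = trans (entry-↾ T reversal i j)
                      (trans (cong (λ b → if b then entry T i j else ∅) (inverted-≮ {reversal} i≮j)) (sym (ut i j i≮j)))

  IsTiling-ρ : ∀ {T} → IsTiling N T → IsTiling N (ρ T)
  IsTiling-ρ {T} r = subst (Reach N reversal) (↾-reversal (ρ T) (UpperTriangular-ρ T))
    (Flips⇒Reach (Flips-ρ (proj₂ (Reach⇒Flips r))))

  ρ-injective : ∀ {T T′} → UpperTriangular T → UpperTriangular T′ → ρ T ≡ ρ T′ → T ≡ T′
  ρ-injective {T} {T′} ut ut′ e = tiling-extensionality h
    where
    ρ-entry≡ : ∀ i j → ρ-entry T i j ≡ ρ-entry T′ i j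
    ρ-entry≡ i j = trans (sym (entry-ρ T i j)) (trans (cong (λ U → entry U i j) e) (entry-ρ T′ i j))
    h : ∀ i j → entry T i j ≡ entry T′ i j
    h i j with toℕ i <? toℕ j
    ... | no i≮j = trans (ut i j i≮j) (sym (ut′ i j i≮j))
    ... | yes i<j with lastView i | lastView j
    ...   | isLast      | _           = ⊥-elim (<⇒≢last i<j refl)
    ...   | isInject₁ a | isLast      = σ-image-injective (ρ-entry≡ zero (suc a))
    ...   | isInject₁ a | isInject₁ b = ρᵛ-injective (trans (sym (entry-ρ-inject₁ T a b a<b))
                                          (trans (cong (λ U → entry U (suc a) (suc b)) e) (entry-ρ-inject₁ T′ a b a<b)))
      where
      a<b : toℕ a < toℕ b
      a<b = subst₂ _<_ (toℕ-inject₁ a) (toℕ-inject₁ b) i<j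

module Reindexing where

  open import Data.Nat using (_≤_)
  open import Data.Nat.Properties using (≤-reflexive; ≤-pred)
  open import Data.Nat.ListAction using (sum)
  open import Data.Nat.ListAction.Properties using (sum-↭)
  open import Data.List using ([]; _∷_; _++_; [_]; map; length)
  open import Data.List.Properties using (length-map; map-∘)
  open import Data.List.Relation.Unary.Any using (here; there)
  open import Data.List.Relation.Unary.All using (All; []; _∷_)
  import Data.List.Relation.Unary.All as All
  open import Data.List.Relation.Unary.All.Properties using () renaming (map⁺ to All-map⁺)
  open import Data.List.Relation.Unary.AllPairs using ([]; _∷_)
  open import Data.List.Membership.Propositional.Properties using (∈-∃++; ∈-map⁻)
  open import Data.List.Relation.Binary.Permutation.Propositional using (_↭_; ↭-refl; ↭-prep; ↭-sym; ↭-trans)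
  open import Data.List.Relation.Binary.Permutation.Propositional.Properties using (shift; ∈-resp-↭; ↭-length; map⁺)
  open import Data.Product using (_,_)
  open import Data.Empty using (⊥-elim)
  open import Relation.Binary.PropositionalEquality using (refl; sym; trans; cong; subst)

  private variable
    A B : Set

  ⊆∧length⇒↭ : ∀ {xs ys : List A} → Unique xs → (∀ {z} → z ∈ xs → z ∈ ys) → length ys ≤ length xs → xs ↭ ys
  ⊆∧length⇒↭ {xs = []}     {[]}    _ _ _  = ↭-refl
  ⊆∧length⇒↭ {xs = x ∷ xs} {ys} (x∉xs ∷ uxs) xs⊆ys len
    with ys₁ , ys₂ , refl ← ∈-∃++ (xs⊆ys (here refl)) =
    ↭-trans (↭-prep x (⊆∧length⇒↭ uxs xs⊆ys′ len′)) (↭-sym ys↭)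
    where
    ys↭ : ys₁ ++ [ x ] ++ ys₂ ↭ x ∷ ys₁ ++ ys₂
    ys↭ = shift x ys₁ ys₂
    xs⊆ys′ : ∀ {z} → z ∈ xs → z ∈ ys₁ ++ ys₂
    xs⊆ys′ z∈xs with ∈-resp-↭ ys↭ (xs⊆ys (there z∈xs))
    ... | here refl = ⊥-elim (All.lookup x∉xs z∈xs refl)
    ... | there p   = p
    len′ : length (ys₁ ++ ys₂) ≤ length xs
    len′ = ≤-pred (subst (_≤ suc (length xs)) (↭-length ys↭) len)

  Unique-map⁺ : ∀ {f : A → B} {xs} → (∀ {x y} → x ∈ xs → y ∈ xs → f x ≡ f y → x ≡ y) → Unique xs → Unique (map f xs)
  Unique-map⁺ {xs = []}     _   []           = []
  Unique-map⁺ {xs = x ∷ xs} inj (x∉xs ∷ uxs) =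
    All-map⁺ (All.tabulate λ y∈xs fx≡fy → All.lookup x∉xs y∈xs (inj (here refl) (there y∈xs) fx≡fy)) ∷
    Unique-map⁺ (λ x∈ y∈ → inj (there x∈) (there y∈)) uxs

  sum-reindex : ∀ {L : List A} (f : A → A) (h : A → ℕ) → Unique L → (∀ {t} → t ∈ L → f t ∈ L) →
                (∀ {s t} → s ∈ L → t ∈ L → f s ≡ f t → s ≡ t) → sum (map (λ t → h (f t)) L) ≡ sum (map h L)
  sum-reindex {L = L} f h uL f∈L f-inj = trans (cong sum (map-∘ L)) (sum-↭ (map⁺ h fL↭L))
    where
    fL↭L : map f L ↭ L
    fL↭L = ⊆∧length⇒↭ (Unique-map⁺ f-inj uL) fL⊆L (≤-reflexive (sym (length-map f L)))
      where
      fL⊆L : ∀ {z} → z ∈ map f L → z ∈ L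
      fL⊆L z∈fL with t , t∈L , refl ← ∈-map⁻ f z∈fL = f∈L t∈L

module PerimeterTiles (m : ℕ) where

  open import Data.Nat using (zero; _<_; _<ᵇ_; z≤n)
  open import Data.Nat.Properties using (<-cmp; <-irrefl; <-trans; <-≤-trans; ≤-<-trans; n<1+n; n≤1+n; <⇒≤; ≤-pred)
  open import Data.Bool using (Bool; true; false; _∧_; _∨_)
  open import Data.Fin using (Fin; zero; suc; toℕ; fromℕ<; inject₁) renaming (_≟_ to _≟ᶠ_)
  open import Data.Fin.Properties using (toℕ-injective; toℕ-fromℕ<; toℕ-inject₁; toℕ<n; fromℕ≢inject₁)
    renaming (<⇒≢ to <⇒≢ᶠ)
  open import Data.Fin.Subset using (Subset; ⁅_⁆; _∪_)
  open import Data.Vec using (lookup; tabulate)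
  open import Data.Vec.Properties using (lookup∘tabulate)
  open import Data.List using ([]; _∷_)
  open import Data.List.Relation.Unary.Any using (Any; here; there)
  import Data.List.Relation.Unary.Any as Any
  open import Data.Product using (_,_; proj₁; proj₂)
  open import Data.Product.Properties using (,-injective)
  open import Data.Empty using (⊥; ⊥-elim)
  open import Function using (case_of_)
  open import Relation.Binary.Definitions using (tri<; tri≈; tri>)
  open import Relation.Nullary using (does)
  open import Relation.Nullary.Decidable using (dec-true; dec-false)
  open import Relation.Binary.PropositionalEquality using (_≢_; refl; cong; cong₂; sym; trans; subst; module ≡-Reasoning)
  open Subsets
  open LastView
  open Labels (suc m)
  open Booleans

  n₁ : ℕ
  n₁ = suc m

  lookup-lowerSet : ∀ {n} (k z : Fin n) → lookup (lowerSet k) z ≡ (toℕ z <ᵇ toℕ k)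
  lookup-lowerSet k = lookup∘tabulate (λ z → toℕ z <ᵇ toℕ k)

  lookup-upperSet : ∀ {n} (k z : Fin n) → lookup (upperSet k) z ≡ (toℕ k <ᵇ toℕ z)
  lookup-upperSet k = lookup∘tabulate (λ z → toℕ k <ᵇ toℕ z)

  ∈-≢-∉ : ∀ {S T : Subset N} z → S ≡ T → lookup S z ≡ true → lookup T z ≡ false → ⊥
  ∈-≢-∉ z refl z∈S z∉T with () ← trans (sym z∈S) z∉T

  <⇒≢zero : ∀ {i j : Lab} → toℕ i < toℕ j → j ≢ zero
  <⇒≢zero () refl

  lowerSet-∪⁅⁆ : ∀ (i j : Lab) → toℕ j ≡ suc (toℕ i) → lowerSet i ∪ ⁅ i ⁆ ≡ lowerSet j
  lowerSet-∪⁅⁆ i j j≡ = lookup-extensionality h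
    where
    i<j : toℕ i < toℕ j
    i<j = subst (toℕ i <_) (sym j≡) (n<1+n (toℕ i))
    h : ∀ z → lookup (lowerSet i ∪ ⁅ i ⁆) z ≡ lookup (lowerSet j) z
    h z with <-cmp (toℕ z) (toℕ i)
    ... | tri< z<i _ _ = trans (lookup-∪ (lowerSet i) ⁅ i ⁆ z)
      (trans (cong (_∨ lookup ⁅ i ⁆ z) (trans (lookup-lowerSet i z) (<⇒<ᵇ≡true z<i)))
        (sym (trans (lookup-lowerSet j z) (<⇒<ᵇ≡true (<-trans z<i i<j)))))
    ... | tri≈ _ z≡i _ with refl ← toℕ-injective z≡i =
      trans (lookup-∪⁅⁆-≡ (lowerSet z) z) (sym (trans (lookup-lowerSet j z) (<⇒<ᵇ≡true i<j)))
    ... | tri> _ _ i<z = trans (lookup-∪⁅⁆-≢ (lowerSet i) (<⇒≢ᶠ i<z))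
      (trans (lookup-lowerSet i z) (trans (≤⇒<ᵇ≡false (<⇒≤ i<z))
        (sym (trans (lookup-lowerSet j z) (≤⇒<ᵇ≡false (subst (_≤ toℕ z) (sym j≡) i<z))))))

  lowerSet-∪⁅⁆⁻¹ : ∀ (i j : Lab) → toℕ i < toℕ j → lowerSet i ∪ ⁅ i ⁆ ≡ lowerSet j → toℕ j ≡ suc (toℕ i)
  lowerSet-∪⁅⁆⁻¹ i j i<j eq with <-cmp (suc (toℕ i)) (toℕ j)
  ... | tri≈ _ e _   = sym e
  ... | tri> _ _ j<  = ⊥-elim (<-irrefl refl (<-≤-trans j< i<j))
  ... | tri< i+1<j _ _ = ⊥-elim (∈-≢-∉ z (sym eq)
      (trans (lookup-lowerSet j z) (trans (cong (_<ᵇ toℕ j) z≡) (<⇒<ᵇ≡true i+1<j)))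
      (trans (lookup-∪⁅⁆-≢ (lowerSet i) (λ i≡z → <-irrefl (cong toℕ i≡z) (subst (toℕ i <_) (sym z≡) (n<1+n _))))
        (trans (lookup-lowerSet i z) (trans (cong (_<ᵇ toℕ i) z≡) (≤⇒<ᵇ≡false (n≤1+n (toℕ i)))))))
    where
    z : Lab
    z = fromℕ< (<-trans i+1<j (toℕ<n j))
    z≡ : toℕ z ≡ suc (toℕ i)
    z≡ = toℕ-fromℕ< (<-trans i+1<j (toℕ<n j))

  upperSet-∪⁅⁆ : ∀ (i j : Lab) → toℕ j ≡ suc (toℕ i) → upperSet j ∪ ⁅ j ⁆ ≡ upperSet i
  upperSet-∪⁅⁆ i j j≡ = lookup-extensionality h
    where
    i<j : toℕ i < toℕ j
    i<j = subst (toℕ i <_) (sym j≡) (n<1+n (toℕ i))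
    h : ∀ z → lookup (upperSet j ∪ ⁅ j ⁆) z ≡ lookup (upperSet i) z
    h z with <-cmp (toℕ z) (toℕ j)
    ... | tri< z<j _ _ = trans (lookup-∪⁅⁆-≢ (upperSet j) (λ j≡z → <-irrefl (cong toℕ (sym j≡z)) z<j))
      (trans (lookup-upperSet j z) (trans (≤⇒<ᵇ≡false (<⇒≤ z<j))
        (sym (trans (lookup-upperSet i z) (≤⇒<ᵇ≡false (≤-pred (subst (toℕ z <_) j≡ z<j)))))))
    ... | tri≈ _ z≡j _ with refl ← toℕ-injective z≡j =
      trans (lookup-∪⁅⁆-≡ (upperSet z) z) (sym (trans (lookup-upperSet i z) (<⇒<ᵇ≡true i<j)))
    ... | tri> _ _ j<z = trans (lookup-∪ (upperSet j) ⁅ j ⁆ z)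
      (trans (cong (_∨ lookup ⁅ j ⁆ z) (trans (lookup-upperSet j z) (<⇒<ᵇ≡true j<z)))
        (sym (trans (lookup-upperSet i z) (<⇒<ᵇ≡true (<-trans i<j j<z)))))

  upperSet-∪⁅⁆⁻¹ : ∀ (i j : Lab) → toℕ i < toℕ j → upperSet j ∪ ⁅ j ⁆ ≡ upperSet i → toℕ j ≡ suc (toℕ i)
  upperSet-∪⁅⁆⁻¹ i j i<j eq with <-cmp (suc (toℕ i)) (toℕ j)
  ... | tri≈ _ e _   = sym e
  ... | tri> _ _ j<  = ⊥-elim (<-irrefl refl (<-≤-trans j< i<j))
  ... | tri< i+1<j _ _ = ⊥-elim (∈-≢-∉ z (sym eq)
      (trans (lookup-upperSet i z) (trans (cong (toℕ i <ᵇ_) z≡) (<⇒<ᵇ≡true (n<1+n (toℕ i)))))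
      (trans (lookup-∪⁅⁆-≢ (upperSet j) (λ j≡z → <-irrefl (sym (trans (cong toℕ j≡z) z≡)) i+1<j))
        (trans (lookup-upperSet j z) (trans (cong (toℕ j <ᵇ_) z≡) (≤⇒<ᵇ≡false (<⇒≤ i+1<j))))))
    where
    z : Lab
    z = fromℕ< (<-trans i+1<j (toℕ<n j))
    z≡ : toℕ z ≡ suc (toℕ i)
    z≡ = toℕ-fromℕ< (<-trans i+1<j (toℕ<n j))

  atLeastTwo : Bool → Bool → Bool → Bool → Bool
  atLeastTwo a b c d = 2 <ᵇ suc (countᵇ (λ x → x) (a ∷ b ∷ c ∷ d ∷ []))

  atLeastTwo⇒first-two : ∀ a b c d → c ≡ false → d ≡ false → atLeastTwo a b c d ≡ true → a ≡ true × b ≡ true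
  atLeastTwo⇒first-two true  true  _     _     _    _    _  = refl , refl
  atLeastTwo⇒first-two true  false false false refl refl ()
  atLeastTwo⇒first-two false true  false false refl refl ()
  atLeastTwo⇒first-two false false false false refl refl ()

  atLeastTwo⇒last-two : ∀ a b c d → a ≡ false → b ≡ false → atLeastTwo a b c d ≡ true → c ≡ true × d ≡ true
  atLeastTwo⇒last-two _     _     true  true  _    _    _  = refl , refl
  atLeastTwo⇒last-two false false true  false refl refl ()
  atLeastTwo⇒last-two false false false true  refl refl ()
  atLeastTwo⇒last-two false false false false refl refl ()

  first-two⇒atLeastTwo : ∀ a b c d → a ≡ true → b ≡ true → atLeastTwo a b c d ≡ true
  first-two⇒atLeastTwo true true _ _ _ _ = refl

  last-two⇒atLeastTwo : ∀ a b c d → c ≡ true → d ≡ true → atLeastTwo a b c d ≡ true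
  last-two⇒atLeastTwo true  true  true true _ _ = refl
  last-two⇒atLeastTwo true  false true true _ _ = refl
  last-two⇒atLeastTwo false true  true true _ _ = refl
  last-two⇒atLeastTwo false false true true _ _ = refl

  -- Of the edges (S, i), (S ∪ {i}, j), (S, j), (S ∪ {j}, i) of a tile i < j whose top S
  -- avoids i and j, only the first two can lie on the left boundary and only the last
  -- two on the right boundary.
  isLeftPerim⇒ : ∀ i j S → toℕ i < toℕ j → Avoids S i j → isLeftPerim (mkTile i j S) ≡ true →
                 S ≡ lowerSet i × toℕ j ≡ suc (toℕ i)
  isLeftPerim⇒ i j S i<j (i∉S , j∉S) e = S≡ , lowerSet-∪⁅⁆⁻¹ i j i<j (trans (cong (_∪ ⁅ i ⁆) (sym S≡)) S∪i≡)
    where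
    third : does (S ≟ˢ lowerSet j) ≡ false
    third = dec-false (S ≟ˢ lowerSet j) λ S≡ →
      ∈-≢-∉ i (sym S≡) (trans (lookup-lowerSet j i) (<⇒<ᵇ≡true i<j)) i∉S
    fourth : does ((S ∪ ⁅ j ⁆) ≟ˢ lowerSet i) ≡ false
    fourth = dec-false ((S ∪ ⁅ j ⁆) ≟ˢ lowerSet i) λ S∪j≡ →
      ∈-≢-∉ j S∪j≡ (lookup-∪⁅⁆-≡ S j) (trans (lookup-lowerSet i j) (≤⇒<ᵇ≡false (<⇒≤ i<j)))
    first-two : does (S ≟ˢ lowerSet i) ≡ true × does ((S ∪ ⁅ i ⁆) ≟ˢ lowerSet j) ≡ true
    first-two = atLeastTwo⇒first-two _ _ _ _ third fourth e
    S≡ : S ≡ lowerSet i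
    S≡ = does≡true⇒ (S ≟ˢ lowerSet i) (proj₁ first-two)
    S∪i≡ : S ∪ ⁅ i ⁆ ≡ lowerSet j
    S∪i≡ = does≡true⇒ ((S ∪ ⁅ i ⁆) ≟ˢ lowerSet j) (proj₂ first-two)

  isLeftPerim-lowerSet : ∀ i j → toℕ j ≡ suc (toℕ i) → isLeftPerim (mkTile i j (lowerSet i)) ≡ true
  isLeftPerim-lowerSet i j j≡ =
    first-two⇒atLeastTwo (does (S ≟ˢ lowerSet i)) (does ((S ∪ ⁅ i ⁆) ≟ˢ lowerSet j))
                         (does (S ≟ˢ lowerSet j)) (does ((S ∪ ⁅ j ⁆) ≟ˢ lowerSet i))
                         (dec-true (S ≟ˢ lowerSet i) refl) (dec-true ((S ∪ ⁅ i ⁆) ≟ˢ lowerSet j) (lowerSet-∪⁅⁆ i j j≡))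
    where
    S : Subset N
    S = lowerSet i

  isRightPerim⇒ : ∀ i j S → toℕ i < toℕ j → Avoids S i j → isRightPerim (mkTile i j S) ≡ true →
                  S ≡ upperSet j × toℕ j ≡ suc (toℕ i)
  isRightPerim⇒ i j S i<j (i∉S , j∉S) e = S≡ , upperSet-∪⁅⁆⁻¹ i j i<j (trans (cong (_∪ ⁅ j ⁆) (sym S≡)) S∪j≡)
    where
    first : does (S ≟ˢ upperSet i) ≡ false
    first = dec-false (S ≟ˢ upperSet i) λ S≡ →
      ∈-≢-∉ j (sym S≡) (trans (lookup-upperSet i j) (<⇒<ᵇ≡true i<j)) j∉S
    second : does ((S ∪ ⁅ i ⁆) ≟ˢ upperSet j) ≡ false
    second = dec-false ((S ∪ ⁅ i ⁆) ≟ˢ upperSet j) λ S∪i≡ →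
      ∈-≢-∉ i S∪i≡ (lookup-∪⁅⁆-≡ S i) (trans (lookup-upperSet j i) (≤⇒<ᵇ≡false (<⇒≤ i<j)))
    last-two : does (S ≟ˢ upperSet j) ≡ true × does ((S ∪ ⁅ j ⁆) ≟ˢ upperSet i) ≡ true
    last-two = atLeastTwo⇒last-two _ _ _ _ first second e
    S≡ : S ≡ upperSet j
    S≡ = does≡true⇒ (S ≟ˢ upperSet j) (proj₁ last-two)
    S∪j≡ : S ∪ ⁅ j ⁆ ≡ upperSet i
    S∪j≡ = does≡true⇒ ((S ∪ ⁅ j ⁆) ≟ˢ upperSet i) (proj₂ last-two)

  isRightPerim-upperSet : ∀ i j → toℕ j ≡ suc (toℕ i) → isRightPerim (mkTile i j (upperSet j)) ≡ true
  isRightPerim-upperSet i j j≡ =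
    last-two⇒atLeastTwo (does (S ≟ˢ upperSet i)) (does ((S ∪ ⁅ i ⁆) ≟ˢ upperSet j))
                        (does (S ≟ˢ upperSet j)) (does ((S ∪ ⁅ j ⁆) ≟ˢ upperSet i))
                        (dec-true (S ≟ˢ upperSet j) refl) (dec-true ((S ∪ ⁅ j ⁆) ≟ˢ upperSet i) (upperSet-∪⁅⁆ i j j≡))
    where
    S : Subset N
    S = upperSet j

  edgeEq⇒≡ : ∀ (e e′ : Edge N) → edgeEq e e′ ≡ true → e ≡ e′
  edgeEq⇒≡ (S , a) (T , b) eq =
    cong₂ _,_ (does≡true⇒ (S ≟ˢ T) (proj₁ (∧≡true⇒ eq))) (does≡true⇒ (a ≟ᶠ b) (proj₂ (∧≡true⇒ eq)))

  edgeEq-refl : ∀ (e : Edge N) → edgeEq e e ≡ true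
  edgeEq-refl (S , a) rewrite dec-true (S ≟ˢ S) refl | dec-true (a ≟ᶠ a) refl = refl

  hasEdge⇒∈ : ∀ x e → hasEdge x e ≡ true → Any (e ≡_) (tileEdges x)
  hasEdge⇒∈ x e = go (tileEdges x)
    where
    go : ∀ es → anyᵇ (edgeEq e) es ≡ true → Any (e ≡_) es
    go (e′ ∷ es) h with edgeEq e e′ in e≡e′
    ... | true  = here (edgeEq⇒≡ e e′ e≡e′)
    ... | false = there (go es h)

  ∈⇒hasEdge : ∀ x e → Any (e ≡_) (tileEdges x) → hasEdge x e ≡ true
  ∈⇒hasEdge x e = go (tileEdges x)
    where
    go : ∀ es → Any (e ≡_) es → anyᵇ (edgeEq e) es ≡ true
    go (e′ ∷ es) (here refl) rewrite edgeEq-refl e = refl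
    go (e′ ∷ es) (there p) with edgeEq e e′
    ... | true  = refl
    ... | false = go es p

  upperSet-last : upperSet last ≡ lowerSet {N} zero
  upperSet-last = lookup-extensionality λ z →
    trans (lookup-upperSet last z) (trans (cong (_<ᵇ toℕ z) toℕ-last)
      (trans (≤⇒<ᵇ≡false (toℕ≤n₁ z)) (sym (lookup-lowerSet zero z))))

  isTopPerim⇒ : ∀ i j S → toℕ i < toℕ j → Avoids S i j → isTopPerim {m} (mkTile i j S) ≡ true →
                i ≡ zero × j ≡ last × S ≡ lowerSet zero
  isTopPerim⇒ i j S i<j _ e = proj₁ (from-left left) , from-right right , proj₂ (from-left left)
    where
    left : Any ((lowerSet zero , zero) ≡_) (tileEdges (mkTile i j S))
    left  = hasEdge⇒∈ (mkTile i j S) _ (proj₁ (∧≡true⇒ e))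
    right : Any ((upperSet last , last) ≡_) (tileEdges (mkTile i j S))
    right = hasEdge⇒∈ (mkTile i j S) _ (proj₂ (∧≡true⇒ e))
    from-left : Any ((lowerSet zero , zero) ≡_) (tileEdges (mkTile i j S)) → i ≡ zero × S ≡ lowerSet zero
    from-left (here p)                     with refl , refl ← ,-injective p = refl , refl
    from-left (there (here p))             = ⊥-elim (<⇒≢zero i<j (sym (proj₂ (,-injective p))))
    from-left (there (there (here p)))     = ⊥-elim (<⇒≢zero i<j (sym (proj₂ (,-injective p))))
    from-left (there (there (there (here p)))) =
      ⊥-elim (∈-≢-∉ j (sym (proj₁ (,-injective p))) (lookup-∪⁅⁆-≡ S j) (lookup-lowerSet zero j))
    from-right : Any ((upperSet last , last) ≡_) (tileEdges (mkTile i j S)) → j ≡ last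
    from-right (here p)                     = ⊥-elim (<⇒≢last i<j (sym (proj₂ (,-injective p))))
    from-right (there (here p))             = ⊥-elim (∈-≢-∉ i (sym (proj₁ (,-injective p))) (lookup-∪⁅⁆-≡ S i)
      (trans (lookup-upperSet last i) (trans (cong (_<ᵇ toℕ i) toℕ-last) (≤⇒<ᵇ≡false (toℕ≤n₁ i)))))
    from-right (there (there (here p)))     = sym (proj₂ (,-injective p))
    from-right (there (there (there (here p)))) = ⊥-elim (<⇒≢last i<j (sym (proj₂ (,-injective p))))

  isTopPerim-lowerSet : isTopPerim {m} (mkTile zero last (lowerSet zero)) ≡ true
  isTopPerim-lowerSet = cong₂ _∧_
    (∈⇒hasEdge (mkTile zero last (lowerSet zero)) _ (here refl))
    (∈⇒hasEdge (mkTile zero last (lowerSet zero)) _ (there (there (here (cong (_, last) upperSet-last)))))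

  -- The top vertex of the bottom-perimeter tile: every label but 1 and n.
  middle : Subset N
  middle = tabulate (λ z → (0 <ᵇ toℕ z) ∧ (toℕ z <ᵇ n₁))

  lookup-middle : ∀ z → lookup middle z ≡ ((0 <ᵇ toℕ z) ∧ (toℕ z <ᵇ n₁))
  lookup-middle = lookup∘tabulate (λ z → (0 <ᵇ toℕ z) ∧ (toℕ z <ᵇ n₁))

  middle-∪⁅zero⁆ : middle ∪ ⁅ zero ⁆ ≡ lowerSet last
  middle-∪⁅zero⁆ = lookup-extensionality h
    where
    h : ∀ z → lookup (middle ∪ ⁅ zero ⁆) z ≡ lookup (lowerSet last) z
    h zero    = trans (lookup-∪⁅⁆-≡ middle zero) (sym (lookup-lowerSet last zero))
    h (suc k) = trans (lookup-∪⁅⁆-≢ middle {zero} {suc k} (λ ())) (trans (lookup-middle (suc k))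
      (sym (trans (lookup-lowerSet last (suc k)) (cong (suc (toℕ k) <ᵇ_) toℕ-last))))

  middle-∪⁅last⁆ : middle ∪ ⁅ last ⁆ ≡ upperSet zero
  middle-∪⁅last⁆ = lookup-extensionality h
    where
    h : ∀ z → lookup (middle ∪ ⁅ last ⁆) z ≡ lookup (upperSet zero) z
    h zero = trans (lookup-∪⁅⁆-≢ middle {last} {zero} (λ ())) (lookup-middle zero)
    h (suc k) with lastView k
    ... | isLast      = trans (lookup-∪⁅⁆-≡ middle last) (sym (lookup-upperSet zero last))
    ... | isInject₁ k′ = trans (lookup-∪⁅⁆-≢ middle (fromℕ≢inject₁ {i = suc k′}))
      (trans (lookup-middle (suc (inject₁ k′)))
        (trans (cong (λ x → suc x <ᵇ n₁) (toℕ-inject₁ k′))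
          (trans (<⇒<ᵇ≡true (toℕ<n k′)) (sym (lookup-upperSet zero (suc (inject₁ k′)))))))

  isBottomPerim⇒ : ∀ i j S → toℕ i < toℕ j → Avoids S i j → isBottomPerim {m} (mkTile i j S) ≡ true →
                   i ≡ zero × j ≡ last × S ≡ middle
  isBottomPerim⇒ i j S i<j (i∉S , j∉S) e = i≡zero , proj₁ (from-left left) , lookup-extensionality S≗middle
    where
    left : Any ((lowerSet last , last) ≡_) (tileEdges (mkTile i j S))
    left  = hasEdge⇒∈ (mkTile i j S) _ (proj₁ (∧≡true⇒ e))
    right : Any ((upperSet zero , zero) ≡_) (tileEdges (mkTile i j S))
    right = hasEdge⇒∈ (mkTile i j S) _ (proj₂ (∧≡true⇒ e))
    from-left : Any ((lowerSet last , last) ≡_) (tileEdges (mkTile i j S)) → j ≡ last × lowerSet last ≡ S ∪ ⁅ i ⁆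
    from-left (here p)                     = ⊥-elim (<⇒≢last i<j (sym (proj₂ (,-injective p))))
    from-left (there (here p))             = sym (proj₂ (,-injective p)) , proj₁ (,-injective p)
    from-left (there (there (here p)))     = ⊥-elim (∈-≢-∉ i (proj₁ (,-injective p))
      (trans (lookup-lowerSet last i) (trans (cong (toℕ i <ᵇ_) toℕ-last) (<⇒<ᵇ≡true (<-≤-trans i<j (toℕ≤n₁ j))))) i∉S)
    from-left (there (there (there (here p)))) = ⊥-elim (<⇒≢last i<j (sym (proj₂ (,-injective p))))
    from-right : Any ((upperSet zero , zero) ≡_) (tileEdges (mkTile i j S)) → i ≡ zero
    from-right (here p)                     = ⊥-elim (∈-≢-∉ j (proj₁ (,-injective p))
      (trans (lookup-upperSet zero j) (<⇒<ᵇ≡true (≤-<-trans z≤n i<j))) j∉S)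
    from-right (there (here p))             = ⊥-elim (<⇒≢zero i<j (sym (proj₂ (,-injective p))))
    from-right (there (there (here p)))     = ⊥-elim (<⇒≢zero i<j (sym (proj₂ (,-injective p))))
    from-right (there (there (there (here p)))) = sym (proj₂ (,-injective p))
    i≡zero : i ≡ zero
    i≡zero = from-right right
    S≗middle : ∀ z → lookup S z ≡ lookup middle z
    S≗middle zero    = trans (subst (λ w → lookup S w ≡ false) i≡zero i∉S) (sym (lookup-middle zero))
    S≗middle (suc k) = begin
      lookup S (suc k)                 ≡⟨ lookup-∪⁅⁆-≢ S {i} {suc k} (λ i≡ → case trans (sym i≡zero) i≡ of λ ()) ⟨
      lookup (S ∪ ⁅ i ⁆) (suc k)       ≡⟨ cong (λ U → lookup U (suc k)) (proj₂ (from-left left)) ⟨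
      lookup (lowerSet last) (suc k)   ≡⟨ cong (λ U → lookup U (suc k)) middle-∪⁅zero⁆ ⟨
      lookup (middle ∪ ⁅ zero ⁆) (suc k) ≡⟨ lookup-∪⁅⁆-≢ middle {zero} {suc k} (λ ()) ⟩
      lookup middle (suc k)            ∎
      where
      open ≡-Reasoning

  isBottomPerim-middle : isBottomPerim {m} (mkTile zero last middle) ≡ true
  isBottomPerim-middle = cong₂ _∧_
    (∈⇒hasEdge (mkTile zero last middle) _ (there (here (cong (_, last) (sym middle-∪⁅zero⁆)))))
    (∈⇒hasEdge (mkTile zero last middle) _ (there (there (there (here (cong (_, zero) (sym middle-∪⁅last⁆)))))))

module PerimeterCounts (m : ℕ) where

  open import Data.Nat using (zero; _+_; _<_; _<ᵇ_; _∸_; _≟_; z≤n; s≤s)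
  open import Data.Nat.Properties
    using (+-identityʳ; suc-injective; ∸-cancelˡ-≡; n<1+n; n≤1+n; ≤-refl; <⇒≤; <-trans; ≤-pred; +-∸-assoc)
  open import Data.Nat.ListAction using (sum)
  open import Data.Bool using (Bool; true; false; not; _∧_; if_then_else_)
  open import Data.Bool.Properties using (⇔→≡; ∧-identityʳ)
  open import Data.Fin using (Fin; zero; suc; toℕ; fromℕ; fromℕ<; inject₁)
  open import Data.Fin.Properties using (toℕ-injective; toℕ-inject₁; toℕ<n; toℕ-fromℕ; toℕ-fromℕ<)
    renaming (suc-injective to Fin-suc-injective)
  open import Data.Fin.Subset using (Subset; ∣_∣)
  open import Data.Vec using (lookup; tabulate; toList; allFin) renaming (map to mapᵛ)
  open import Data.Vec.Properties using (allFin-map; toList-map)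
  open import Data.List using (List; []; _∷_; _++_; map; concatMap)
  open import Data.List.Properties using (map-∘)
  open import Data.Product using (_,_; proj₁; proj₂)
  open import Data.Empty using (⊥-elim)
  open import Function using (mk⇔; _∘′_)
  open import Relation.Nullary using (does; ¬_)
  open import Relation.Nullary.Decidable using (dec-true; does-⇔)
  open import Relation.Binary.PropositionalEquality using (_≢_; refl; cong; cong₂; sym; trans; subst; subst₂; module ≡-Reasoning)
  open Booleans
  open Subsets using (lookup-extensionality)
  open Labels (suc m)
  open Flips (suc m) using (entry)
  open Rotation (suc m) using (ρ; entry-ρ; entry-ρ-inject₁)
  open RotatedTilings (suc m) using (WellLabelled)
  open PerimeterTiles m

  private variable
    A B : Set

  ind : Bool → ℕ
  ind b = if b then 1 else 0

  tileAt : Tiling N → Lab → Lab → Tile N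
  tileAt t i j = mkTile i j (entry t i j)

  count : (Tile N → Bool) → Tiling N → ℕ
  count P t = countᵇ P (tiles t)

  countᵇ-++ : ∀ (P : A → Bool) xs ys → countᵇ P (xs ++ ys) ≡ countᵇ P xs + countᵇ P ys
  countᵇ-++ P []       ys = refl
  countᵇ-++ P (x ∷ xs) ys with P x
  ... | true  = cong suc (countᵇ-++ P xs ys)
  ... | false = countᵇ-++ P xs ys

  countᵇ-concatMap : ∀ (P : B → Bool) (f : A → List B) xs →
                     countᵇ P (concatMap f xs) ≡ sum (map (λ x → countᵇ P (f x)) xs)
  countᵇ-concatMap P f []       = refl
  countᵇ-concatMap P f (x ∷ xs) =
    trans (countᵇ-++ P (f x) (concatMap f xs)) (cong (countᵇ P (f x) +_) (countᵇ-concatMap P f xs))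

  sumFin : ∀ n → (Fin n → ℕ) → ℕ
  sumFin n g = sum (map g (toList (allFin n)))

  sumFin-suc : ∀ n (g : Fin (suc n) → ℕ) → sumFin (suc n) g ≡ g zero + sumFin n (λ i → g (suc i))
  sumFin-suc n g = begin
    sum (map g (toList (allFin (suc n))))               ≡⟨ cong (sum ∘′ map g ∘′ toList) (allFin-map n) ⟩
    sum (map g (zero ∷ toList (mapᵛ suc (allFin n))))   ≡⟨ cong (λ l → sum (map g (zero ∷ l))) (toList-map suc (allFin n)) ⟩
    g zero + sum (map g (map suc (toList (allFin n))))  ≡⟨ cong (λ l → g zero + sum l) (map-∘ (toList (allFin n))) ⟨
    g zero + sumFin n (λ i → g (suc i))                 ∎
    where open ≡-Reasoning

  sumFin-zero : ∀ n (g : Fin n → ℕ) → (∀ i → g i ≡ 0) → sumFin n g ≡ 0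
  sumFin-zero zero    g h = refl
  sumFin-zero (suc n) g h = trans (sumFin-suc n g) (cong₂ _+_ (h zero) (sumFin-zero n _ (λ i → h (suc i))))

  sumFin-single : ∀ n (g : Fin n → ℕ) i₀ → (∀ i → i ≢ i₀ → g i ≡ 0) → sumFin n g ≡ g i₀
  sumFin-single (suc n) g zero     h = trans (sumFin-suc n g)
    (trans (cong (g zero +_) (sumFin-zero n _ (λ i → h (suc i) (λ ())))) (+-identityʳ (g zero)))
  sumFin-single (suc n) g (suc i₀) h = trans (sumFin-suc n g)
    (trans (cong (_+ sumFin n (λ i → g (suc i))) (h zero (λ ())))
      (sumFin-single n (λ i → g (suc i)) i₀ (λ i i≢i₀ → h (suc i) (i≢i₀ ∘′ Fin-suc-injective))))

  count-single : ∀ (P : Tile N → Bool) t i₀ j₀ → toℕ i₀ < toℕ j₀ →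
                 (∀ i j → toℕ i < toℕ j → P (tileAt t i j) ≡ true → i ≡ i₀ × j ≡ j₀) →
                 count P t ≡ ind (P (tileAt t i₀ j₀))
  count-single P t i₀ j₀ i₀<j₀ only =
    trans (countᵇ-concatMap P row (toList (allFin N)))
      (trans (sumFin-single N (λ i → countᵇ P (row i)) i₀ other-row)
        (trans (countᵇ-concatMap P (cell i₀) (toList (allFin N)))
          (trans (sumFin-single N (λ j → countᵇ P (cell i₀ j)) j₀ (λ j j≢j₀ → other-cell i₀ j (j≢j₀ ∘′ proj₂)))
            the-cell)))
    where
    cell : Lab → Lab → List (Tile N)
    cell i j = if toℕ i <ᵇ toℕ j then tileAt t i j ∷ [] else []
    row : Lab → List (Tile N)
    row i = concatMap (cell i) (toList (allFin N))
    other-cell : ∀ i j → ¬ (i ≡ i₀ × j ≡ j₀) → countᵇ P (cell i j) ≡ 0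
    other-cell i j ¬ij with toℕ i <ᵇ toℕ j in i<ᵇj
    ... | false = refl
    ... | true with P (tileAt t i j) in Pij
    ...   | true  = ⊥-elim (¬ij (only i j (<ᵇ≡true⇒< i<ᵇj) Pij))
    ...   | false = refl
    other-row : ∀ i → i ≢ i₀ → countᵇ P (row i) ≡ 0
    other-row i i≢i₀ = trans (countᵇ-concatMap P (cell i) (toList (allFin N)))
      (sumFin-zero N _ (λ j → other-cell i j (i≢i₀ ∘′ proj₁)))
    the-cell : countᵇ P (cell i₀ j₀) ≡ ind (P (tileAt t i₀ j₀))
    the-cell rewrite <⇒<ᵇ≡true i₀<j₀ with P (tileAt t i₀ j₀)
    ... | true  = refl
    ... | false = refl

  count-characterised : ∀ (P : Tile N → Bool) {i₀ j₀ S₀} → toℕ i₀ < toℕ j₀ →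
    (∀ i j S → toℕ i < toℕ j → Avoids S i j → P (mkTile i j S) ≡ true → i ≡ i₀ × j ≡ j₀ × S ≡ S₀) →
    P (mkTile i₀ j₀ S₀) ≡ true →
    ∀ t → WellLabelled t → count P t ≡ ind (does (entry t i₀ j₀ ≟ˢ S₀))
  count-characterised P {i₀} {j₀} {S₀} i₀<j₀ char P₀ t wl =
    trans (count-single P t i₀ j₀ i₀<j₀ only) (cong ind (⇔→≡ (mk⇔ to from)))
    where
    only : ∀ i j → toℕ i < toℕ j → P (tileAt t i j) ≡ true → i ≡ i₀ × j ≡ j₀
    only i j i<j Pij with char i j _ i<j (wl i j) Pij
    ... | i≡ , j≡ , _ = i≡ , j≡
    to : P (tileAt t i₀ j₀) ≡ true → does (entry t i₀ j₀ ≟ˢ S₀) ≡ true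
    to P≡ = dec-true (entry t i₀ j₀ ≟ˢ S₀) (proj₂ (proj₂ (char i₀ j₀ _ i₀<j₀ (wl i₀ j₀) P≡)))
    from : does (entry t i₀ j₀ ≟ˢ S₀) ≡ true → P (tileAt t i₀ j₀) ≡ true
    from e = subst (λ S → P (mkTile i₀ j₀ S) ≡ true) (sym (does≡true⇒ (entry t i₀ j₀ ≟ˢ S₀) e)) P₀

  leftPerimAt rightPerimAt : ℕ → Tile N → Bool
  leftPerimAt  d x = isLeftPerim x ∧ depthIs d x
  rightPerimAt d x = isRightPerim x ∧ depthIs d x

  ∣tabulate-false∣ : ∀ n → ∣ tabulate {n = n} (λ _ → false) ∣ ≡ 0
  ∣tabulate-false∣ zero    = refl
  ∣tabulate-false∣ (suc n) = ∣tabulate-false∣ n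

  ∣tabulate-true∣ : ∀ n → ∣ tabulate {n = n} (λ _ → true) ∣ ≡ n
  ∣tabulate-true∣ zero    = refl
  ∣tabulate-true∣ (suc n) = cong suc (∣tabulate-true∣ n)

  ∣lowerSet∣ : ∀ {n} (i : Fin n) → ∣ lowerSet i ∣ ≡ toℕ i
  ∣lowerSet∣ {suc n} zero    = ∣tabulate-false∣ n
  ∣lowerSet∣ {suc n} (suc i) = cong suc (∣lowerSet∣ i)

  ∣upperSet∣ : ∀ {n} (j : Fin (suc n)) → ∣ upperSet j ∣ ≡ n ∸ toℕ j
  ∣upperSet∣ {n}     zero    = ∣tabulate-true∣ n
  ∣upperSet∣ {suc n} (suc j) = ∣upperSet∣ j

  depthIs⇒ : ∀ {d} (x : Tile N) → depthIs d x ≡ true → d ≡ suc ∣ topV x ∣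
  depthIs⇒ {d} x = does≡true⇒ (d ≟ suc ∣ topV x ∣)

  ⇒depthIs : ∀ {d} (x : Tile N) → d ≡ suc ∣ topV x ∣ → depthIs d x ≡ true
  ⇒depthIs {d} x = dec-true (d ≟ suc ∣ topV x ∣)

  adjacent⇒< : ∀ {i j : Lab} → toℕ j ≡ suc (toℕ i) → toℕ i < toℕ j
  adjacent⇒< {i} j≡ = subst (toℕ i <_) (sym j≡) (n<1+n (toℕ i))

  count-top : ∀ t → WellLabelled t → count (isTopPerim {m}) t ≡ ind (does (entry t zero last ≟ˢ lowerSet zero))
  count-top = count-characterised isTopPerim (s≤s z≤n) isTopPerim⇒ isTopPerim-lowerSet

  count-bottom : ∀ t → WellLabelled t → count (isBottomPerim {m}) t ≡ ind (does (entry t zero last ≟ˢ middle))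
  count-bottom = count-characterised isBottomPerim (s≤s z≤n) isBottomPerim⇒ isBottomPerim-middle

  count-left : ∀ d {i j} → toℕ j ≡ suc (toℕ i) → d ≡ suc (toℕ i) →
               ∀ t → WellLabelled t → count (leftPerimAt d) t ≡ ind (does (entry t i j ≟ˢ lowerSet i))
  count-left d {i₀} {j₀} j₀≡ d≡ = count-characterised (leftPerimAt d) (adjacent⇒< j₀≡) char
    (cong₂ _∧_ (isLeftPerim-lowerSet i₀ j₀ j₀≡)
               (⇒depthIs (mkTile i₀ j₀ (lowerSet i₀)) (trans d≡ (cong suc (sym (∣lowerSet∣ {N} i₀))))))
    where
    char : ∀ i j S → toℕ i < toℕ j → Avoids S i j → leftPerimAt d (mkTile i j S) ≡ true →
           i ≡ i₀ × j ≡ j₀ × S ≡ lowerSet i₀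
    char i j S i<j avoids e with refl , j≡ ← isLeftPerim⇒ i j S i<j avoids (proj₁ (∧≡true⇒ e)) = i≡ , j≡j₀ , cong lowerSet i≡
      where
      i≡ : i ≡ i₀
      i≡ = toℕ-injective (suc-injective (trans (cong suc (sym (∣lowerSet∣ {N} i)))
             (trans (sym (depthIs⇒ (mkTile i j S) (proj₂ (∧≡true⇒ e)))) d≡)))
      j≡j₀ : j ≡ j₀
      j≡j₀ = toℕ-injective (trans j≡ (trans (cong (suc ∘′ toℕ) i≡) (sym j₀≡)))

  count-right : ∀ d {i j} → toℕ j ≡ suc (toℕ i) → d ≡ suc (suc m ∸ toℕ j) →
                ∀ t → WellLabelled t → count (rightPerimAt d) t ≡ ind (does (entry t i j ≟ˢ upperSet j))
  count-right d {i₀} {j₀} j₀≡ d≡ = count-characterised (rightPerimAt d) (adjacent⇒< j₀≡) char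
    (cong₂ _∧_ (isRightPerim-upperSet i₀ j₀ j₀≡)
               (⇒depthIs (mkTile i₀ j₀ (upperSet j₀)) (trans d≡ (cong suc (sym (∣upperSet∣ {n₁} j₀))))))
    where
    char : ∀ i j S → toℕ i < toℕ j → Avoids S i j → rightPerimAt d (mkTile i j S) ≡ true →
           i ≡ i₀ × j ≡ j₀ × S ≡ upperSet j₀
    char i j S i<j avoids e with refl , j≡ ← isRightPerim⇒ i j S i<j avoids (proj₁ (∧≡true⇒ e)) =
      toℕ-injective (suc-injective (trans (sym j≡) (trans (cong toℕ j≡j₀) j₀≡))) , j≡j₀ , cong upperSet j≡j₀
      where
      j≡j₀ : j ≡ j₀
      j≡j₀ = toℕ-injective (∸-cancelˡ-≡ (toℕ≤n₁ j) (toℕ≤n₁ j₀) (suc-injective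
               (trans (cong suc (sym (∣upperSet∣ {n₁} j))) (trans (sym (depthIs⇒ (mkTile i j (upperSet j)) (proj₂ (∧≡true⇒ e)))) d≡))))

  σ-image-lowerSet-zero : σ-image (lowerSet zero) ≡ lowerSet zero
  σ-image-lowerSet-zero = lookup-extensionality λ z →
    trans (lookup-σ-image (lowerSet zero) z) (trans (lookup-lowerSet zero (τ z)) (sym (lookup-lowerSet zero z)))

  ρᵛ-lowerSet : ∀ (a : Fin n₁) → ρᵛ (lowerSet (inject₁ a)) ≡ lowerSet (suc a)
  ρᵛ-lowerSet a = lookup-extensionality h
    where
    h : ∀ z → lookup (ρᵛ (lowerSet (inject₁ a))) z ≡ lookup (lowerSet (suc a)) z
    h zero    = cong not (trans (lookup-lowerSet (inject₁ a) last)
      (trans (cong₂ _<ᵇ_ toℕ-last (toℕ-inject₁ a)) (≤⇒<ᵇ≡false (<⇒≤ (toℕ<n a)))))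
    h (suc k) = trans (lookup-ρᵛ-suc (lowerSet (inject₁ a)) k) (trans (lookup-lowerSet (inject₁ a) (inject₁ k))
      (trans (cong₂ _<ᵇ_ (toℕ-inject₁ k) (toℕ-inject₁ a)) (sym (lookup-lowerSet (suc a) (suc k)))))

  σ-image-lowerSet-middle : ∀ (a : Lab) → toℕ a ≡ m → σ-image (lowerSet a) ≡ middle
  σ-image-lowerSet-middle a a≡m = lookup-extensionality h
    where
    h : ∀ z → lookup (σ-image (lowerSet a)) z ≡ lookup middle z
    h zero    = trans (lookup-σ-image (lowerSet a) zero) (trans (lookup-lowerSet a last)
      (trans (cong₂ _<ᵇ_ toℕ-last a≡m) (trans (≤⇒<ᵇ≡false (n≤1+n m)) (sym (lookup-middle zero)))))
    h (suc k) = trans (lookup-σ-image (lowerSet a) (suc k)) (trans (lookup-lowerSet a (inject₁ k))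
      (trans (cong₂ _<ᵇ_ (toℕ-inject₁ k) a≡m) (sym (lookup-middle (suc k)))))

  σ-image-middle : σ-image middle ≡ upperSet (suc zero)
  σ-image-middle = lookup-extensionality h
    where
    h : ∀ z → lookup (σ-image middle) z ≡ lookup (upperSet (suc zero)) z
    h zero    = trans (lookup-σ-image middle zero) (trans (lookup-middle last)
      (trans (cong (λ x → (0 <ᵇ x) ∧ (x <ᵇ n₁)) toℕ-last)
        (trans (cong ((0 <ᵇ n₁) ∧_) (≤⇒<ᵇ≡false {n₁} ≤-refl)) (sym (lookup-upperSet {N} (suc zero) zero)))))
    h (suc k) = trans (lookup-σ-image middle (suc k)) (trans (lookup-middle (inject₁ k))
      (trans (cong (λ x → (0 <ᵇ x) ∧ (x <ᵇ n₁)) (toℕ-inject₁ k))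
        (trans (cong ((0 <ᵇ toℕ k) ∧_) (<⇒<ᵇ≡true (toℕ<n k)))
          (trans (∧-identityʳ (0 <ᵇ toℕ k)) (sym (lookup-upperSet {N} (suc zero) (suc k)))))))

  ρᵛ-upperSet : ∀ (b : Fin n₁) → ρᵛ (upperSet (inject₁ b)) ≡ upperSet (suc b)
  ρᵛ-upperSet b = lookup-extensionality h
    where
    h : ∀ z → lookup (ρᵛ (upperSet (inject₁ b))) z ≡ lookup (upperSet (suc b)) z
    h zero    = cong not (trans (lookup-upperSet (inject₁ b) last)
      (trans (cong₂ _<ᵇ_ (toℕ-inject₁ b) toℕ-last) (<⇒<ᵇ≡true (toℕ<n b))))
    h (suc k) = trans (lookup-ρᵛ-suc (upperSet (inject₁ b)) k) (trans (lookup-upperSet (inject₁ b) (inject₁ k))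
      (trans (cong₂ _<ᵇ_ (toℕ-inject₁ b) (toℕ-inject₁ k)) (sym (lookup-upperSet (suc b) (suc k)))))

  count-ρ : ∀ {P Q} t {S₀ S₁} (i₀ j₀ i₁ j₁ : Lab) (φ : Subset N → Subset N) → (∀ {S T} → φ S ≡ φ T → S ≡ T) →
            count P t ≡ ind (does (entry t i₀ j₀ ≟ˢ S₀)) →
            count Q (ρ t) ≡ ind (does (entry (ρ t) i₁ j₁ ≟ˢ S₁)) →
            entry (ρ t) i₁ j₁ ≡ φ (entry t i₀ j₀) → φ S₀ ≡ S₁ → count P t ≡ count Q (ρ t)
  count-ρ t {S₀} {S₁} i₀ j₀ i₁ j₁ φ φ-injective countP countQ entry≡ φS₀ =
    trans countP (trans (cong ind same) (sym countQ))
    where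
    same : does (entry t i₀ j₀ ≟ˢ S₀) ≡ does (entry (ρ t) i₁ j₁ ≟ˢ S₁)
    same = does-⇔ (mk⇔ (λ e → trans entry≡ (trans (cong φ e) φS₀))
                       (λ e → φ-injective (trans (sym entry≡) (trans e (sym φS₀)))))
                  (entry t i₀ j₀ ≟ˢ S₀) (entry (ρ t) i₁ j₁ ≟ˢ S₁)

  module AdjacentBelowLast (k : ℕ) (k+1<n₁ : suc k < n₁) where

    a b : Fin n₁
    a = fromℕ< (<-trans (n<1+n k) k+1<n₁)
    b = fromℕ< k+1<n₁

    toℕ-a : toℕ (inject₁ a) ≡ k
    toℕ-a = trans (toℕ-inject₁ a) (toℕ-fromℕ< (<-trans (n<1+n k) k+1<n₁))

    toℕ-b : toℕ (inject₁ b) ≡ suc k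
    toℕ-b = trans (toℕ-inject₁ b) (toℕ-fromℕ< k+1<n₁)

    inject₁-adjacent : toℕ (inject₁ b) ≡ suc (toℕ (inject₁ a))
    inject₁-adjacent = trans toℕ-b (cong suc (sym toℕ-a))

    suc-adjacent : toℕ (suc b) ≡ suc (toℕ (suc a))
    suc-adjacent = cong suc (trans (sym (toℕ-inject₁ b)) (trans inject₁-adjacent (cong suc (toℕ-inject₁ a))))

    a<b : toℕ a < toℕ b
    a<b = subst₂ _<_ (sym (toℕ-fromℕ< (<-trans (n<1+n k) k+1<n₁))) (sym (toℕ-fromℕ< k+1<n₁)) (n<1+n k)

  module _ (t : Tiling N) (wl : WellLabelled t) (wlρ : WellLabelled (ρ t)) where

    top↦left : count (isTopPerim {m}) t ≡ count (leftPerimAt 1) (ρ t)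
    top↦left = count-ρ t zero last zero (suc zero) σ-image σ-image-injective (count-top t wl)
      (count-left 1 {zero} {suc zero} refl refl (ρ t) wlρ) (entry-ρ t zero (suc zero)) σ-image-lowerSet-zero

    left↦left : ∀ k → suc k < n₁ → count (leftPerimAt (suc k)) t ≡ count (leftPerimAt (suc (suc k))) (ρ t)
    left↦left k k+1<n₁ = count-ρ t (inject₁ a) (inject₁ b) (suc a) (suc b) ρᵛ ρᵛ-injective
      (count-left (suc k) inject₁-adjacent (cong suc (sym toℕ-a)) t wl)
      (count-left (suc (suc k)) suc-adjacent (cong (λ x → suc (suc x)) (trans (sym toℕ-a) (toℕ-inject₁ a))) (ρ t) wlρ)
      (entry-ρ-inject₁ t a b a<b) (ρᵛ-lowerSet a)
      where open AdjacentBelowLast k k+1<n₁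

    left↦bottom : count (leftPerimAt n₁) t ≡ count (isBottomPerim {m}) (ρ t)
    left↦bottom = count-ρ t (inject₁ (fromℕ m)) last zero last σ-image σ-image-injective
      (count-left n₁ (trans toℕ-last (cong suc (sym toℕ-a))) (cong suc (sym toℕ-a)) t wl)
      (count-bottom (ρ t) wlρ) (entry-ρ t zero (suc (fromℕ m))) (σ-image-lowerSet-middle (inject₁ (fromℕ m)) toℕ-a)
      where
      toℕ-a : toℕ (inject₁ (fromℕ m)) ≡ m
      toℕ-a = trans (toℕ-inject₁ (fromℕ m)) (toℕ-fromℕ m)

    bottom↦right : count (isBottomPerim {m}) t ≡ count (rightPerimAt n₁) (ρ t)
    bottom↦right = count-ρ t zero last zero (suc zero) σ-image σ-image-injective (count-bottom t wl)
      (count-right n₁ {zero} {suc zero} refl refl (ρ t) wlρ) (entry-ρ t zero (suc zero)) σ-image-middle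

    right↦right : ∀ k → suc k < n₁ →
                  count (rightPerimAt (suc (n₁ ∸ suc k))) t ≡ count (rightPerimAt (n₁ ∸ suc k)) (ρ t)
    right↦right k k+1<n₁ = count-ρ t (inject₁ a) (inject₁ b) (suc a) (suc b) ρᵛ ρᵛ-injective
      (count-right _ inject₁-adjacent (cong (λ x → suc (n₁ ∸ x)) (sym toℕ-b)) t wl)
      (count-right _ suc-adjacent
        (trans (+-∸-assoc 1 (≤-pred k+1<n₁)) (cong (λ x → suc (m ∸ x)) (trans (sym toℕ-b) (toℕ-inject₁ b)))) (ρ t) wlρ)
      (entry-ρ-inject₁ t a b a<b) (ρᵛ-upperSet b)
      where open AdjacentBelowLast k k+1<n₁

module Totals (m : ℕ) (L : List (Tiling (suc (suc m)))) (uL : Unique L)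
  (sound : ∀ t → t ∈ L → IsTiling (suc (suc m)) t) (complete : ∀ t → IsTiling (suc (suc m)) t → t ∈ L) where

  open import Data.Nat using (zero; _<_; _∸_; s≤s)
  open import Data.Nat.Properties using (<-trans; n<1+n; ≤-pred; <⇒≤; +-∸-assoc; m∸n≤m; m∸[m∸n]≡n)
  open import Data.Nat.ListAction using (sum)
  open import Data.List.Properties using (map-cong-local)
  import Data.List.Relation.Unary.All as All
  open import Relation.Binary.PropositionalEquality using (cong; sym; trans; subst)
  open Rotation (suc m) using (ρ)
  open RotatedTilings (suc m)
  open Reindexing using (sum-reindex)
  open PerimeterCounts m

  n₁ : ℕ
  n₁ = suc m

  total-ρ : ∀ {P Q} → (∀ t → WellLabelled t → WellLabelled (ρ t) → count P t ≡ count Q (ρ t)) → total P L ≡ total Q L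
  total-ρ {P} {Q} step =
    trans (cong sum (map-cong-local (All.tabulate λ {t} t∈L →
            step t (Reach⇒WellLabelled (sound t t∈L)) (Reach⇒WellLabelled (IsTiling-ρ (sound t t∈L))))))
          (sum-reindex ρ (count Q) uL
            (λ {t} t∈L → complete (ρ t) (IsTiling-ρ (sound t t∈L)))
            (λ {s} {t} s∈L t∈L → ρ-injective (Reach⇒UpperTriangular (sound s s∈L)) (Reach⇒UpperTriangular (sound t t∈L))))

  total-left : ∀ k → k < n₁ → total (leftPerimAt (suc k)) L ≡ total (isTopPerim {m}) L
  total-left zero    _      = sym (total-ρ top↦left)
  total-left (suc k) k+1<n₁ =
    trans (sym (total-ρ (λ t wl wlρ → left↦left t wl wlρ k k+1<n₁))) (total-left k (<-trans (n<1+n k) k+1<n₁))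

  total-bottom : total (isBottomPerim {m}) L ≡ total (isTopPerim {m}) L
  total-bottom = trans (sym (total-ρ left↦bottom)) (total-left m (n<1+n m))

  total-right : ∀ k → k < n₁ → total (rightPerimAt (n₁ ∸ k)) L ≡ total (isTopPerim {m}) L
  total-right zero    _      = trans (sym (total-ρ bottom↦right)) total-bottom
  total-right (suc k) k+1<n₁ =
    trans (sym (total-ρ (λ t wl wlρ → right↦right t wl wlρ k k+1<n₁)))
      (subst (λ d → total (rightPerimAt d) L ≡ total isTopPerim L) (+-∸-assoc 1 (<⇒≤ (≤-pred k+1<n₁)))
        (total-right k (<-trans (n<1+n k) k+1<n₁)))

  total-leftAt : ∀ d → 1 ≤ d → d ≤ n₁ → total (leftPerimAt d) L ≡ total (isTopPerim {m}) L
  total-leftAt (suc k) _ d≤n₁ = total-left k d≤n₁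

  total-rightAt : ∀ d → 1 ≤ d → d ≤ n₁ → total (rightPerimAt d) L ≡ total (isTopPerim {m}) L
  total-rightAt (suc k) _ d≤n₁ = subst (λ d → total (rightPerimAt d) L ≡ total isTopPerim L) (m∸[m∸n]≡n d≤n₁)
    (total-right (n₁ ∸ suc k) (s≤s (m∸n≤m m k)))

proposition3p3 : (m : ℕ) → (L : List (Tiling (suc (suc m)))) → Unique L →
    (∀ t → t ∈ L → IsTiling (suc (suc m)) t) → (∀ t → IsTiling (suc (suc m)) t → t ∈ L) →
    (total isBottomPerim L ≡ total isTopPerim L)
    × (∀ d → 1 ≤ d → d ≤ suc m →
         (total (λ x → isLeftPerim x ∧ depthIs d x) L ≡ total isTopPerim L)
         × (total (λ x → isRightPerim x ∧ depthIs d x) L ≡ total isTopPerim L))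
proposition3p3 m L uL sound complete =
  total-bottom , λ d 1≤d d≤n₁ → total-leftAt d 1≤d d≤n₁ , total-rightAt d 1≤d d≤n₁
  where
  open import Data.Product using (_,_)
  open Totals m L uL sound complete
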